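{- For every positive integer $r$, the cycle matroid $M_r = M(G_r)$ of the graph $G_r$ (defined in the context), with ground set $\{1,2,\dots,2r\}$ ordered by the natural order $1<2<\dots<2r$, is internally perfect.
   Context: The graphs $G_r=(V_r,E_r)$ are defined recursively, with labelled edges. $G_1$ has vertex set $\{1,2\}$ and two parallel edges, labelled $1$ and $2$, both joining vertices $1$ and $2$. For $r>1$, $G_r$ is obtained from $G_{r-1}$ by adding a new vertex $r+1$, an edge labelled $2r-1$ joining $r$ and $r+1$, and an edge labelled $2r$ joining $1$ and $r+1$. $M_r$ is the cycle matroid of $G_r$ on the edge set $\{1,\dots,2r\}$. (In the paper $M_r$ is defined equivalently by $M_1=M(C_2)$ and $M_r=\mathrm{PE}(\mathrm{PL}(M_{r-1},\emptyset),\{2r-2,2r-1\})$, where $\mathrm{PE}$ and $\mathrm{PL}$ denote principal extension and principal lift.) Internal activity. Let $M$ be a matroid on a totally ordered ground set $E$ and let $B$ be a basis of $M$. For $e\in B$, the fundamental cocircuit $C^*(B;e)$ is the unique cocircuit contained in $(E\setminus B)\cup\{e\}$. The element $e$ is internally active in $B$ if $e=\min C^*(B;e)$, and internally passive otherwise. Write $\mathrm{IP}(B)$ for the set of internally passive elements of $B$. Internal order. The internal order $P_{\mathrm{Int}}(M)$ is Las Vergnas' internal order on the bases of $M$: $B\le B'$ if and only if $\mathrm{IP}(B)\subseteq \mathrm{IP}(B')$. Principal bases. A basis $B$ is $f$-principal if it is join-irreducible in $P_{\mathrm{Int}}(M)$ (it covers exactly one basis) and $f=\max \mathrm{IP}(B)$.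 Write such a basis as $f^{T}_{A}$, where $T=\mathrm{IP}(B)\setminus\{f\}$ and $A=B\setminus \mathrm{IP}(B)$ is the set of internally active elements. Decomposition of a basis. Every basis $B$ is the join of the principal bases below it. Let $S(B)$ be the set of elements $f$ such that some maximal principal basis below $B$ is $f$-principal; for $f\in S(B)$ let this be $B_f=f^{T_f}_{A_f}$. Set $T(B;f)=T_f$ (the "$f$-part") and $T(B)=\mathrm{IP}(B)\setminus S(B)$. Perfection. $B$ is internally perfect if $T(B)$ is the disjoint union $\bigsqcup_{f\in S(B)} T(B;f)$. The ordered matroid $M$ is internally perfect if every basis of $M$ is internally perfect. -}

module Defs where

open import Data.Nat using (ℕ; zero; suc; _+_)
open import Data.Fin using (Fin; _≤_)
open import Data.Fin.Subset using (Subset; _∈_; _∉_; _⊆_; _∪_; _∩_; ∁; ⁅_⁆; _-_; Empty)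
open import Data.Vec using (Vec; []; _∷_; _∷ʳ_; lookup)
open import Data.Product using (_×_; _,_; Σ; ∃; ∃-syntax)
open import Data.Sum using (_⊎_)
open import Relation.Binary.PropositionalEquality using (_≡_; _≢_)
open import Relation.Nullary using (¬_)
open import Function.Bundles using (_⇔_)

-- The graphs G_r.
-- dbl r = 2r (defined so that dbl (suc r) reduces to suc (suc (dbl r))).

dbl : ℕ → ℕ
dbl zero = 0
dbl (suc r) = suc (suc (dbl r))

-- The element i : Fin (dbl r) is the edge with label (toℕ i + 1); the ground
-- set {1,...,2r} is thus Fin (2r), and its natural order is the order on Fin.
-- G_1: edges 1,2 both join 1 and 2.
-- G_r (r > 1): G_{r-1} plus edge 2r-1 joining r, r+1 and edge 2r joining 1, r+1.
edgesG : (r : ℕ) → Vec (ℕ × ℕ) (dbl r)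
edgesG zero = []
edgesG (suc zero) = (1 , 2) ∷ (1 , 2) ∷ []
edgesG (suc (suc r)) = (edgesG (suc r) ∷ʳ (2 + r , 3 + r)) ∷ʳ (1 , 3 + r)

module CycleMatroid {n : ℕ} (E : Vec (ℕ × ℕ) n) where

  Joins : Fin n → ℕ → ℕ → Set
  Joins i u w = let (a , b) = lookup E i in
    (a ≡ u × b ≡ w) ⊎ (a ≡ w × b ≡ u)

  data Reach (S : Subset n) : ℕ → ℕ → Set where
    here : ∀ {u} → Reach S u u
    step : ∀ {u w v} (i : Fin n) → i ∈ S → Joins i u w → Reach S w v → Reach S u v

  Independent : Subset n → Set
  Independent S = ∀ i → i ∈ S → ∀ u w → Joins i u w → ¬ Reach (S - i) u w

  Basis : Subset n → Set
  Basis B = Independent B × (∀ i → i ∉ B → ¬ Independent (B ∪ ⁅ i ⁆))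

  CoIndependent : Subset n → Set
  CoIndependent X = ∃[ B ] (Basis B × Empty (X ∩ B))

  Cocircuit : Subset n → Set
  Cocircuit C = ¬ CoIndependent C × (∀ Y → Y ⊆ C → Y ≢ C → CoIndependent Y)

  FundCocircuit : Subset n → Fin n → Subset n → Set
  FundCocircuit B e C = Cocircuit C × C ⊆ (∁ B ∪ ⁅ e ⁆)

  IsMin : Fin n → Subset n → Set
  IsMin e C = e ∈ C × (∀ x → x ∈ C → e ≤ x)

  IsMaxOf : Fin n → (Fin n → Set) → Set
  IsMaxOf f P = P f × (∀ x → P x → x ≤ f)

  InternallyActive : Subset n → Fin n → Set
  InternallyActive B e = e ∈ B × ∃[ C ] (FundCocircuit B e C × IsMin e C)

  InternallyPassive : Subset n → Fin n → Set
  InternallyPassive B e = e ∈ B × ¬ InternallyActive B e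

  _≤Int_ : Subset n → Subset n → Set
  B ≤Int B' = Basis B × Basis B' × (∀ e → InternallyPassive B e → InternallyPassive B' e)

  _<Int_ : Subset n → Subset n → Set
  B <Int B' = B ≤Int B' × ¬ (B' ≤Int B)

  Covers : Subset n → Subset n → Set
  Covers B B' = B' <Int B × (∀ B'' → B' <Int B'' → ¬ (B'' <Int B))

  JoinIrreducible : Subset n → Set
  JoinIrreducible B = Basis B × ∃[ B' ] (Covers B B' × (∀ B'' → Covers B B'' → B'' ≡ B'))

  Principal : Subset n → Fin n → Set
  Principal B f = JoinIrreducible B × IsMaxOf f (InternallyPassive B)

  MaxPrincipalBelow : Subset n → Subset n → Fin n → Set
  MaxPrincipalBelow B P f =
    Principal P f × P ≤Int B ×
    (∀ P' f' → Principal P' f' → P' ≤Int B → ¬ (P <Int P'))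

  InS : Subset n → Fin n → Set
  InS B f = ∃[ P ] MaxPrincipalBelow B P f

  InPart : Subset n → Fin n → Subset n → Fin n → Set
  InPart B f P e = MaxPrincipalBelow B P f × InternallyPassive P e × e ≢ f

  InT : Subset n → Fin n → Set
  InT B e = InternallyPassive B e × ¬ InS B e

  InternallyPerfectBasis : Subset n → Set
  InternallyPerfectBasis B =
    (∀ e → InT B e ⇔ (∃[ f ] ∃[ P ] InPart B f P e)) ×
    (∀ e f f' P P' → InPart B f P e → InPart B f' P' e → f ≡ f')

  InternallyPerfect : Set
  InternallyPerfect = ∀ B → Basis B → InternallyPerfectBasis B

InternallyPerfectM : ℕ → Set
InternallyPerfectM r = CycleMatroid.InternallyPerfect (edgesG r)

-- G_r is a fan: the rim path 1 - 2 - ... - (r+1) together with spokes from the hub 1 to every rim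
-- vertex, the labels alternating between rim edges and spokes. Read a spanning tree from left to
-- right: its spokes are always internally passive, and a rim edge of the tree is passive exactly
-- when its lower end is not yet joined to the hub by smaller edges (the fundamental cut is then also
-- crossed by the missing rim edge where that run of rim edges begins). So the passive set splits into
-- blocks, each made of a spoke and the maximal run of passive rim edges just below it. A basis is
-- join-irreducible in the internal order exactly when its passive set is one block: it then covers
-- only the basis obtained by dropping the least block element through a single exchange. Hence the
-- maximal principal bases below B are indexed by the spokes of B, their passive sets are the blocks
-- of B, S(B) is the set of spokes of B, and the parts T(B; f) are the rim parts of the blocks, which
-- partition the passive rim edges T(B).

module Submission where

open import Data.Bool using (Bool; true; false; not; _∧_; _∨_; if_then_else_)
open import Data.Bool.Properties as Boolₚ using (∨-zeroʳ; ∨-identityʳ; ∧-zeroʳ)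
open import Data.Empty using (⊥; ⊥-elim)
open import Data.Fin using (Fin; zero; suc; toℕ; fromℕ<)
import Data.Fin.Properties as Finₚ
open import Data.Fin.Subset using (Subset; _∈_; _∉_; _⊆_; _∪_; _∩_; _-_; ∁; ⁅_⁆; Empty)
open import Data.Fin.Subset.Properties
  using (x∈⁅x⁆; x∈⁅y⁆⇒x≡y; x∈p∪q⁻; x∈p∪q⁺; x∈p∩q⁺; x∈p∩q⁻; x∉p⇒x∈∁p; x∈∁p⇒x∉p;
         p─q⊆p; x∈p∧x∉q⇒x∈p─q; ⊆-antisym; _∈?_)
open import Data.Nat using (ℕ; zero; suc; _+_; _∸_; _<_; _≤_; _≥_; z≤n; s≤s; pred; _≤?_; _<?_)
  renaming (_≟_ to _≟ℕ_)
open import Data.Nat.Properties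
open import Data.Product using (_×_; _,_; ∃-syntax; proj₁; proj₂)
open import Data.Sum using (_⊎_; inj₁; inj₂; [_,_]′)
open import Data.Unit using (⊤; tt)
open import Data.Vec using (Vec; []; _∷_; lookup; tabulate; _∷ʳ_; here; there)
open import Data.Vec.Properties using ([]=⇒lookup; lookup⇒[]=; lookup∘tabulate)
open import Function using (_∘_)
open import Function.Bundles using (mk⇔)
open import Relation.Binary.Definitions using (tri<; tri≈; tri>)
open import Relation.Binary.PropositionalEquality
open import Relation.Nullary using (¬_; yes; no; Dec; does; contradiction)
open import Relation.Nullary.Decidable using (decidable-stable; dec-true; dec-false; ¬?; _×-dec_; _→-dec_)
open import Defs

-- Cuts and internal activity in cycle matroids

does≡true⇒ : ∀ {P : Set} (d : Dec P) → does d ≡ true → P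
does≡true⇒ (yes p) _ = p

x∈p-y⇒x≢y : ∀ {m} {x y : Fin m} {p} → x ∈ p - y → x ≢ y
x∈p-y⇒x≢y {x = x} {p = p} x∈ refl = go p x x∈
  where
  go : ∀ {k} (q : Subset k) z → z ∉ q - z
  go (_ ∷ q) zero ()
  go (_ ∷ q) (suc z) (there h) = go q z h

x∈p∧x≢y⇒x∈p-y : ∀ {m} {x y : Fin m} {p} → x ∈ p → x ≢ y → x ∈ p - y
x∈p∧x≢y⇒x∈p-y {y = y} x∈ x≢y = x∈p∧x∉q⇒x∈p─q x∈ (x≢y ∘ x∈⁅y⁆⇒x≡y y)

x∈p-y⇒x∈p : ∀ {m} {x y : Fin m} {p} → x ∈ p - y → x ∈ p
x∈p-y⇒x∈p {y = y} {p} = p─q⊆p p ⁅ y ⁆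

module CycleMatroidFacts {n : ℕ} (E : Vec (ℕ × ℕ) n) where
  open CycleMatroid E

  source target : Fin n → ℕ
  source j = proj₁ (lookup E j)
  target j = proj₂ (lookup E j)

  Joins-ends : (j : Fin n) → Joins j (source j) (target j)
  Joins-ends j = inj₁ (refl , refl)

  Joins-sym : ∀ {j u w} → Joins j u w → Joins j w u
  Joins-sym (inj₁ (a , b)) = inj₂ (a , b)
  Joins-sym (inj₂ (a , b)) = inj₁ (a , b)

  IsEnd : Fin n → ℕ → Set
  IsEnd j a = a ≡ source j ⊎ a ≡ target j

  Joins⇒IsEnd : ∀ {j u w} → Joins j u w → IsEnd j u × IsEnd j w
  Joins⇒IsEnd (inj₁ (a , b)) = inj₁ (sym a) , inj₂ (sym b)
  Joins⇒IsEnd (inj₂ (a , b)) = inj₂ (sym b) , inj₁ (sym a)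

  Reach-mono : ∀ {S T u v} → S ⊆ T → Reach S u v → Reach T u v
  Reach-mono S⊆T here = here
  Reach-mono S⊆T (step i i∈ j r) = step i (S⊆T i∈) j (Reach-mono S⊆T r)

  Reach-trans : ∀ {S u v w} → Reach S u v → Reach S v w → Reach S u w
  Reach-trans here r' = r'
  Reach-trans (step i i∈ j r) r' = step i i∈ j (Reach-trans r r')

  Reach-sym : ∀ {S u v} → Reach S u v → Reach S v u
  Reach-sym here = here
  Reach-sym (step i i∈ j r) = Reach-trans (Reach-sym r) (step i i∈ (Joins-sym j) here)

  Reach-untilFirst : ∀ {S x v} (e : Fin n) → Reach S x v →
    Reach (S - e) x v ⊎ ∃[ a ] (IsEnd e a × Reach (S - e) x a)
  Reach-untilFirst e here = inj₁ here
  Reach-untilFirst {x = x} e (step i i∈ j r) with i Finₚ.≟ e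
  ... | yes refl = inj₂ (x , proj₁ (Joins⇒IsEnd j) , here)
  ... | no i≢e with Reach-untilFirst e r
  ...   | inj₁ r' = inj₁ (step i (x∈p∧x≢y⇒x∈p-y i∈ i≢e) j r')
  ...   | inj₂ (a , ea , r') = inj₂ (a , ea , step i (x∈p∧x≢y⇒x∈p-y i∈ i≢e) j r')

  Reach-afterLast : ∀ {S x v} (e : Fin n) → Reach S x v →
    Reach (S - e) x v ⊎ ∃[ a ] (IsEnd e a × Reach (S - e) a v)
  Reach-afterLast e here = inj₁ here
  Reach-afterLast e (step i i∈ j r) with Reach-afterLast e r
  ... | inj₂ res = inj₂ res
  ... | inj₁ r' with i Finₚ.≟ e
  ...   | yes refl = inj₂ (_ , proj₂ (Joins⇒IsEnd j) , r')
  ...   | no i≢e = inj₁ (step i (x∈p∧x≢y⇒x∈p-y i∈ i≢e) j r')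

  Independent-anti : ∀ {S T} → S ⊆ T → Independent T → Independent S
  Independent-anti S⊆T indT i i∈ u w j r =
    indT i (S⊆T i∈) u w j (Reach-mono (λ k∈ → x∈p∧x≢y⇒x∈p-y (S⊆T (x∈p-y⇒x∈p k∈)) (x∈p-y⇒x≢y k∈)) r)

  Respects : Subset n → (ℕ → Bool) → Set
  Respects S c = ∀ i → i ∈ S → c (source i) ≡ c (target i)

  Crosses : Fin n → (ℕ → Bool) → Set
  Crosses j c = c (source j) ≢ c (target j)

  Joins-respects : ∀ {j u w} (c : ℕ → Bool) → c (source j) ≡ c (target j) → Joins j u w → c u ≡ c w
  Joins-respects c e (inj₁ (refl , refl)) = e
  Joins-respects c e (inj₂ (refl , refl)) = sym e

  Joins-respects⁻ : ∀ {j u w} (c : ℕ → Bool) → Joins j u w → c u ≡ c w → c (source j) ≡ c (target j)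
  Joins-respects⁻ c (inj₁ (refl , refl)) e = e
  Joins-respects⁻ c (inj₂ (refl , refl)) e = sym e

  Reach-respects : ∀ {S u v} (c : ℕ → Bool) → Respects S c → Reach S u v → c u ≡ c v
  Reach-respects c resp here = refl
  Reach-respects c resp (step i i∈ j r) = trans (Joins-respects c (resp i i∈) j) (Reach-respects c resp r)

  IsEnd-colour : ∀ {j a b} (c : ℕ → Bool) → IsEnd j a → IsEnd j b → c a ≡ c b →
    a ≡ b ⊎ c (source j) ≡ c (target j)
  IsEnd-colour c (inj₁ refl) (inj₁ refl) _ = inj₁ refl
  IsEnd-colour c (inj₂ refl) (inj₂ refl) _ = inj₁ refl
  IsEnd-colour c (inj₁ refl) (inj₂ refl) e = inj₂ e
  IsEnd-colour c (inj₂ refl) (inj₁ refl) e = inj₂ (sym e)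

  Independent-∪-crossing : ∀ {T} (c : ℕ → Bool) (y : Fin n) → Independent T → Respects T c →
    Crosses y c → Independent (T ∪ ⁅ y ⁆)
  Independent-∪-crossing {T} c y indT resp crosses i i∈ u w i-joins walk with x∈p∪q⁻ T ⁅ y ⁆ i∈
  ... | inj₂ i∈y with refl ← x∈⁅y⁆⇒x≡y y i∈y =
    crosses (Joins-respects⁻ c i-joins (Reach-respects c resp (Reach-mono drop-y walk)))
    where
    drop-y : (T ∪ ⁅ y ⁆) - y ⊆ T
    drop-y k∈ = [ (λ k∈T → k∈T) , (λ k∈y → contradiction (x∈⁅y⁆⇒x≡y y k∈y) (x∈p-y⇒x≢y k∈)) ]′
                  (x∈p∪q⁻ T ⁅ y ⁆ (x∈p-y⇒x∈p k∈))
  ... | inj₁ i∈T = cycle (Reach-untilFirst y walk) (Reach-afterLast y walk)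
    where
    drop-y : (T ∪ ⁅ y ⁆) - i - y ⊆ T - i
    drop-y k∈ = [ (λ k∈T → x∈p∧x≢y⇒x∈p-y k∈T (x∈p-y⇒x≢y (x∈p-y⇒x∈p k∈)))
                , (λ k∈y → contradiction (x∈⁅y⁆⇒x≡y y k∈y) (x∈p-y⇒x≢y k∈)) ]′
                  (x∈p∪q⁻ T ⁅ y ⁆ (x∈p-y⇒x∈p (x∈p-y⇒x∈p k∈)))
    resp-i : Respects (T - i) c
    resp-i k k∈ = resp k (x∈p-y⇒x∈p k∈)
    cycle : Reach ((T ∪ ⁅ y ⁆) - i - y) u w ⊎ ∃[ a ] (IsEnd y a × Reach ((T ∪ ⁅ y ⁆) - i - y) u a) →
            Reach ((T ∪ ⁅ y ⁆) - i - y) u w ⊎ ∃[ b ] (IsEnd y b × Reach ((T ∪ ⁅ y ⁆) - i - y) b w) → ⊥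
    cycle (inj₁ avoid) _ = indT i i∈T u w i-joins (Reach-mono drop-y avoid)
    cycle (inj₂ _) (inj₁ avoid) = indT i i∈T u w i-joins (Reach-mono drop-y avoid)
    cycle (inj₂ (a , a-end , ua)) (inj₂ (b , b-end , bw))
      with IsEnd-colour c a-end b-end
             (trans (sym (Reach-respects c resp-i (Reach-mono drop-y ua)))
               (trans (Joins-respects c (resp i i∈T) i-joins) (sym (Reach-respects c resp-i (Reach-mono drop-y bw)))))
    ... | inj₁ refl = indT i i∈T u w i-joins (Reach-mono drop-y (Reach-trans ua bw))
    ... | inj₂ y-respects = crosses y-respects

  crosses? : ∀ j c → Dec (Crosses j c)
  crosses? j c = ¬? (c (source j) Boolₚ.≟ c (target j))

  cut : (ℕ → Bool) → Subset n
  cut c = tabulate (λ j → does (crosses? j c))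

  ∈cut⇒Crosses : ∀ c {j} → j ∈ cut c → Crosses j c
  ∈cut⇒Crosses c {j} j∈ =
    does≡true⇒ (crosses? j c) (trans (sym (lookup∘tabulate _ j)) ([]=⇒lookup j∈))

  Crosses⇒∈cut : ∀ c {j} → Crosses j c → j ∈ cut c
  Crosses⇒∈cut c {j} crosses =
    lookup⇒[]= j (cut c) (trans (lookup∘tabulate _ j) (dec-true (crosses? j c) crosses))

  module Spanning (root : ℕ) (V : ℕ → Set) (ends-in-V : ∀ j → V (source j) × V (target j)) where

    Connected : Subset n → Set
    Connected B = ∀ x → V x → Reach B x root

    connected-independent⇒Basis : ∀ {B} → Independent B → Connected B → Basis B
    connected-independent⇒Basis {B} indB connB = indB , λ i i∉B ind′ →
      ind′ i (x∈p∪q⁺ (inj₂ (x∈⁅x⁆ i))) (source i) (target i) (Joins-ends i)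
        (Reach-mono (λ k∈B → x∈p∧x≢y⇒x∈p-y (x∈p∪q⁺ (inj₁ k∈B)) (λ { refl → i∉B k∈B }))
          (Reach-trans (connB _ (proj₁ (ends-in-V i))) (Reach-sym (connB _ (proj₂ (ends-in-V i))))))

    -- B - e has two components, each containing an end of e; c is constant on both, so an edge whose
    -- ends get different colours reconnects them.
    exchange-Basis : ∀ {B} → Independent B → Connected B → ∀ {e} → e ∈ B →
      ∀ c → Respects (B - e) c → ∀ {y} → Crosses y c → Basis ((B - e) ∪ ⁅ y ⁆)
    exchange-Basis {B} indB connB {e} e∈B c resp {y} y-crosses =
      connected-independent⇒Basis
        (Independent-∪-crossing c y (Independent-anti x∈p-y⇒x∈p indB) resp y-crosses)
        (λ x x∈V → Reach-trans (toSource (toEnd x x∈V)) (Reach-sym (toSource root-toEnd)))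
      where
      B′ : Subset n
      B′ = (B - e) ∪ ⁅ y ⁆

      B-e⊆B′ : B - e ⊆ B′
      B-e⊆B′ k∈ = x∈p∪q⁺ (inj₁ k∈)

      root-toEnd : ∃[ z ] (IsEnd e z × Reach (B - e) root z)
      root-toEnd with Reach-untilFirst e (Reach-sym (connB _ (proj₁ (ends-in-V e))))
      ... | inj₁ walk = _ , inj₁ refl , walk
      ... | inj₂ res = res

      toEnd : ∀ x → V x → ∃[ z ] (IsEnd e z × Reach (B - e) x z)
      toEnd x x∈V with Reach-untilFirst e (connB x x∈V)
      ... | inj₂ res = res
      ... | inj₁ walk = let (z , z-end , root-z) = root-toEnd in z , z-end , Reach-trans walk root-z

      ends-linked : Reach B′ (source e) (target e)
      ends-linked with toEnd _ (proj₁ (ends-in-V y)) | toEnd _ (proj₂ (ends-in-V y))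
      ... | z₁ , z₁-end , walk₁ | z₂ , z₂-end , walk₂ =
        link z₁-end z₂-end (Reach-respects c resp walk₁) (Reach-respects c resp walk₂)
        where
        through-y : Reach B′ z₁ z₂
        through-y = Reach-trans (Reach-mono B-e⊆B′ (Reach-sym walk₁))
                      (step y (x∈p∪q⁺ (inj₂ (x∈⁅x⁆ y))) (Joins-ends y) (Reach-mono B-e⊆B′ walk₂))
        link : IsEnd e z₁ → IsEnd e z₂ → c (source y) ≡ c z₁ → c (target y) ≡ c z₂ →
          Reach B′ (source e) (target e)
        link (inj₁ refl) (inj₁ refl) c₁ c₂ = contradiction (trans c₁ (sym c₂)) y-crosses
        link (inj₂ refl) (inj₂ refl) c₁ c₂ = contradiction (trans c₁ (sym c₂)) y-crosses
        link (inj₁ refl) (inj₂ refl) _ _ = through-y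
        link (inj₂ refl) (inj₁ refl) _ _ = Reach-sym through-y

      toSource : ∀ {x} → ∃[ z ] (IsEnd e z × Reach (B - e) x z) → Reach B′ x (source e)
      toSource (z , inj₁ refl , walk) = Reach-mono B-e⊆B′ walk
      toSource (z , inj₂ refl , walk) = Reach-trans (Reach-mono B-e⊆B′ walk) (Reach-sym ends-linked)

    -- A cocircuit inside (E ∖ B) ∪ {e} meets every exchange partner of e, so it contains any smaller
    -- crossing edge x.
    passive-if-smaller-crossing : ∀ {B} → Independent B → Connected B → ∀ {e} → e ∈ B →
      ∀ c → Respects (B - e) c → ∀ {x} → Crosses x c → toℕ x < toℕ e → InternallyPassive B e
    passive-if-smaller-crossing {B} indB connB {e} e∈B c resp {x} x-crosses x<e =
      e∈B , λ { (_ , C , (C-cocircuit , C⊆) , (_ , e-min)) → <⇒≱ x<e (e-min x (x∈C C-cocircuit C⊆)) }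
      where
      x∈C : ∀ {C} → Cocircuit C → C ⊆ (∁ B ∪ ⁅ e ⁆) → x ∈ C
      x∈C {C} (C-dependent , _) C⊆ with x ∈? C
      ... | yes x∈C = x∈C
      ... | no x∉C = contradiction
              ((B - e) ∪ ⁅ x ⁆ , exchange-Basis indB connB e∈B c resp x-crosses , disjoint)
              C-dependent
        where
        disjoint : Empty (C ∩ ((B - e) ∪ ⁅ x ⁆))
        disjoint (z , z∈) with x∈p∩q⁻ C _ z∈
        ... | z∈C , z∈B′ with x∈p∪q⁻ (B - e) ⁅ x ⁆ z∈B′ | x∈p∪q⁻ (∁ B) ⁅ e ⁆ (C⊆ z∈C)
        ...   | inj₂ z∈x | _ with refl ← x∈⁅y⁆⇒x≡y x z∈x = x∉C z∈C
        ...   | inj₁ z∈B-e | inj₁ z∈∁B = x∈∁p⇒x∉p z∈∁B (x∈p-y⇒x∈p z∈B-e)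
        ...   | inj₁ z∈B-e | inj₂ z∈e = x∈p-y⇒x≢y z∈B-e (x∈⁅y⁆⇒x≡y e z∈e)

    -- When e is the least crossing edge, the crossing edges form the fundamental cocircuit of e.
    active-if-least-crossing : ∀ {B} → Independent B → Connected B → ∀ {e} → e ∈ B →
      ∀ c → Respects (B - e) c → Crosses e c → (∀ x → Crosses x c → toℕ e ≤ toℕ x) →
      InternallyActive B e
    active-if-least-crossing {B} indB connB {e} e∈B c resp e-crosses e-least =
      e∈B , cut c , ((cut-dependent , cut-minimal) , cut⊆) , Crosses⇒∈cut c e-crosses ,
      λ x x∈cut → e-least x (∈cut⇒Crosses c x∈cut)
      where
      cut-dependent : ¬ CoIndependent (cut c)
      cut-dependent (B′ , (indB′ , maxB′) , disjoint) =
        maxB′ e e∉B′ (Independent-∪-crossing c e indB′ resp′ e-crosses)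
        where
        e∉B′ : e ∉ B′
        e∉B′ e∈B′ = disjoint (e , x∈p∩q⁺ (Crosses⇒∈cut c e-crosses , e∈B′))
        resp′ : Respects B′ c
        resp′ i i∈B′ with crosses? i c
        ... | yes i-crosses = contradiction (i , x∈p∩q⁺ (Crosses⇒∈cut c i-crosses , i∈B′)) disjoint
        ... | no ¬crosses = decidable-stable (c (source i) Boolₚ.≟ c (target i)) ¬crosses
      cut-minimal : ∀ Y → Y ⊆ cut c → Y ≢ cut c → CoIndependent Y
      cut-minimal Y Y⊆cut Y≢cut with Finₚ.¬∀⟶∃¬ n (λ i → i ∈ cut c → i ∈ Y) (λ i → i ∈? cut c →-dec i ∈? Y)
                                       (λ cut⊆Y → Y≢cut (⊆-antisym Y⊆cut (cut⊆Y _)))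
      ... | y , y∉ with y ∈? cut c | y ∈? Y
      ...   | no y∉cut | _ = contradiction (λ y∈cut → contradiction y∈cut y∉cut) y∉
      ...   | yes _ | yes y∈Y = contradiction (λ _ → y∈Y) y∉
      ...   | yes y∈cut | no y∉Y =
              (B - e) ∪ ⁅ y ⁆ , exchange-Basis indB connB e∈B c resp (∈cut⇒Crosses c y∈cut) , disjoint
        where
        disjoint : Empty (Y ∩ ((B - e) ∪ ⁅ y ⁆))
        disjoint (z , z∈) with x∈p∩q⁻ Y _ z∈
        ... | z∈Y , z∈B′ with x∈p∪q⁻ (B - e) ⁅ y ⁆ z∈B′
        ...   | inj₂ z∈y with refl ← x∈⁅y⁆⇒x≡y y z∈y = y∉Y z∈Y
        ...   | inj₁ z∈B-e = ∈cut⇒Crosses c (Y⊆cut z∈Y) (resp z z∈B-e)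
      cut⊆ : cut c ⊆ (∁ B ∪ ⁅ e ⁆)
      cut⊆ {z} z∈cut with z Finₚ.≟ e | z ∈? B
      ... | yes refl | _ = x∈p∪q⁺ (inj₂ (x∈⁅x⁆ e))
      ... | no z≢e | yes z∈B = contradiction (resp z (x∈p∧x≢y⇒x∈p-y z∈B z≢e)) (∈cut⇒Crosses c z∈cut)
      ... | no _ | no z∉B = x∈p∪q⁺ (inj₁ (x∉p⇒x∈∁p z∉B))

-- Codes of edge sets of the fan

true≢false : true ≢ false
true≢false ()

dbl-mono-< : ∀ {k m} → k < m → dbl k < dbl m
dbl-mono-< {zero} {suc m} _ = s≤s z≤n
dbl-mono-< {suc k} {suc m} (s≤s h) = s≤s (s≤s (dbl-mono-< h))

dbl-mono-≤ : ∀ {k m} → k ≤ m → dbl k ≤ dbl m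
dbl-mono-≤ {zero} _ = z≤n
dbl-mono-≤ {suc k} {suc m} (s≤s h) = s≤s (s≤s (dbl-mono-≤ h))

dbl-cancel-< : ∀ {k m} → dbl k < dbl m → k < m
dbl-cancel-< {zero} {suc m} _ = s≤s z≤n
dbl-cancel-< {suc k} {suc m} (s≤s (s≤s h)) = s≤s (dbl-cancel-< h)

1+dbl<dbl⇒< : ∀ {k m} → suc (dbl k) < dbl m → k < m
1+dbl<dbl⇒< {zero} {suc m} _ = s≤s z≤n
1+dbl<dbl⇒< {suc k} {suc m} (s≤s (s≤s h)) = s≤s (1+dbl<dbl⇒< h)

<⇒1+dbl<dbl : ∀ {k m} → k < m → suc (dbl k) < dbl m
<⇒1+dbl<dbl {zero} {suc m} _ = s≤s (s≤s z≤n)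
<⇒1+dbl<dbl {suc k} {suc m} (s≤s h) = s≤s (s≤s (<⇒1+dbl<dbl h))

dbl-injective : ∀ {k m} → dbl k ≡ dbl m → k ≡ m
dbl-injective {zero} {zero} _ = refl
dbl-injective {suc k} {suc m} h = cong suc (dbl-injective (suc-injective (suc-injective h)))

dbl≢1+dbl : ∀ {k m} → dbl k ≢ suc (dbl m)
dbl≢1+dbl {suc k} {suc m} h = dbl≢1+dbl {k} {m} (suc-injective (suc-injective h))

even-or-odd : ∀ ℓ → (∃[ k ] ℓ ≡ dbl k) ⊎ (∃[ k ] ℓ ≡ suc (dbl k))
even-or-odd zero = inj₁ (0 , refl)
even-or-odd (suc ℓ) with even-or-odd ℓ
... | inj₁ (k , refl) = inj₂ (k , refl)
... | inj₂ (k , refl) = inj₁ (suc k , refl)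

data Parity : ℕ → Set where
  even : ∀ k → Parity (dbl k)
  odd : ∀ k → Parity (suc (dbl k))

parity : ∀ ℓ → Parity ℓ
parity zero = even zero
parity (suc ℓ) with parity ℓ
... | even k = odd k
... | odd k = even (suc k)

parity-even : ∀ k → parity (dbl k) ≡ even k
parity-even zero = refl
parity-even (suc k) rewrite parity-even k = refl

parity-odd : ∀ k → parity (suc (dbl k)) ≡ odd k
parity-odd k rewrite parity-even k = refl

-- A set of edges of the fan G_r is read as a code b : ℕ → Bool; element 2k (label 2k + 1) is the
-- rim edge {k+1, k+2} and element 2k+1 (label 2k + 2) the spoke {1, k+2}. linked b k records whether
-- rim vertex k+1 is joined to the hub 1 by the elements below 2k, and okAt b k is the condition at
-- vertex k+1 under which the elements 2k, 2k+1 neither close a cycle nor leave k+1 cut off for good.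

hubStep : Bool → Bool → Bool → Bool
hubStep σ true q = σ ∨ q
hubStep σ false q = q

linked : (ℕ → Bool) → ℕ → Bool
linked b zero = true
linked b (suc k) = hubStep (linked b k) (b (dbl k)) (b (suc (dbl k)))

okStep : Bool → Bool → Bool → Bool
okStep σ true q = not (σ ∧ q)
okStep σ false q = σ

okAt : (ℕ → Bool) → ℕ → Bool
okAt b k = okStep (linked b k) (b (dbl k)) (b (suc (dbl k)))

WellFormed : ℕ → (ℕ → Bool) → Set
WellFormed r b = ∀ k → k ≤ r → okAt b k ≡ true

VanishesFrom : ℕ → (ℕ → Bool) → Set
VanishesFrom N b = ∀ ℓ → N ≤ ℓ → b ℓ ≡ false

-- Vertices runStart b k + 1, …, k + 1 are joined by the rim edges of b, and runStart b k is least such.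
runStart : (ℕ → Bool) → ℕ → ℕ
runStart b zero = zero
runStart b (suc k) = if b (dbl k) then runStart b k else suc k

passiveBy : (ℕ → Bool) → ∀ {ℓ} → Parity ℓ → Bool
passiveBy b (even k) = b (dbl k) ∧ not (linked b k)
passiveBy b (odd k) = b (suc (dbl k))

passive : (ℕ → Bool) → ℕ → Bool
passive b ℓ = passiveBy b (parity ℓ)

passive-even : ∀ b k → passive b (dbl k) ≡ b (dbl k) ∧ not (linked b k)
passive-even b k rewrite parity-even k = refl

passive-odd : ∀ b k → passive b (suc (dbl k)) ≡ b (suc (dbl k))
passive-odd b k rewrite parity-odd k = refl

passive-rim⁻ : ∀ b k → passive b (dbl k) ≡ true → b (dbl k) ≡ true × linked b k ≡ false
passive-rim⁻ b k h with b (dbl k) | linked b k | trans (sym (passive-even b k)) h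
... | true | false | _ = refl , refl

passive-rim⁺ : ∀ b k → b (dbl k) ≡ true → linked b k ≡ false → passive b (dbl k) ≡ true
passive-rim⁺ b k p q rewrite passive-even b k | p | q = refl

passive⇒∈ : ∀ b ℓ → passive b ℓ ≡ true → b ℓ ≡ true
passive⇒∈ b ℓ h with parity ℓ
... | odd k = h
... | even k with b (dbl k)
...   | true = refl
...   | false = h

∉⇒¬passive : ∀ b ℓ → b ℓ ≡ false → passive b ℓ ≡ false
∉⇒¬passive b ℓ h with parity ℓ
... | even k rewrite h = refl
... | odd k = h

linked-cong : ∀ {b b′} → b ≗ b′ → ∀ k → linked b k ≡ linked b′ k
linked-cong h zero = refl
linked-cong h (suc k) rewrite h (dbl k) | h (suc (dbl k)) | linked-cong h k = refl

okAt-cong : ∀ {b b′} → b ≗ b′ → ∀ k → okAt b k ≡ okAt b′ k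
okAt-cong h k rewrite h (dbl k) | h (suc (dbl k)) | linked-cong h k = refl

passive-cong : ∀ {b b′} → b ≗ b′ → ∀ ℓ → passive b ℓ ≡ passive b′ ℓ
passive-cong h ℓ with parity ℓ
... | even k rewrite h (dbl k) | linked-cong h k = refl
... | odd k = h (suc (dbl k))

WellFormed-cong : ∀ {r b b′} → b ≗ b′ → WellFormed r b → WellFormed r b′
WellFormed-cong h wf k k≤r = trans (sym (okAt-cong h k)) (wf k k≤r)

runStart≤ : ∀ b k → runStart b k ≤ k
runStart≤ b zero = z≤n
runStart≤ b (suc k) with b (dbl k)
... | true = m≤n⇒m≤1+n (runStart≤ b k)
... | false = ≤-refl

runStart-extend : ∀ b k → b (dbl k) ≡ true → runStart b (suc k) ≡ runStart b k
runStart-extend b k h rewrite h = refl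

runStart-restart : ∀ b k → b (dbl k) ≡ false → runStart b (suc k) ≡ suc k
runStart-restart b k h rewrite h = refl

runStart-mono : ∀ b {i k} → i ≤ k → runStart b i ≤ runStart b k
runStart-mono b {k = zero} z≤n = ≤-refl
runStart-mono b {i} {suc k} i≤1+k with m≤n⇒m<n∨m≡n i≤1+k
... | inj₂ refl = ≤-refl
... | inj₁ (s≤s i≤k) = ≤-trans (runStart-mono b i≤k) (step k)
  where
  step : ∀ k → runStart b k ≤ runStart b (suc k)
  step k with b (dbl k)
  ... | true = ≤-refl
  ... | false = m≤n⇒m≤1+n (runStart≤ b k)

runStart-idem : ∀ b k → runStart b (runStart b k) ≡ runStart b k
runStart-idem b zero = refl
runStart-idem b (suc k) with b (dbl k) in eq
... | true = runStart-idem b k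
... | false = runStart-restart b k eq

linked-viaSpoke : ∀ b k → b (suc (dbl k)) ≡ true → linked b (suc k) ≡ true
linked-viaSpoke b k h with b (dbl k)
... | true rewrite h = ∨-zeroʳ _
... | false = h

linked-alongRun : ∀ b {i k} → i ≤ k → runStart b i ≡ runStart b k → linked b i ≡ true → linked b k ≡ true
linked-alongRun b {k = zero} z≤n _ h = h
linked-alongRun b {i} {suc k} i≤1+k same h with m≤n⇒m<n∨m≡n i≤1+k
... | inj₂ refl = h
... | inj₁ (s≤s i≤k) with b (dbl k) in eb
...   | true rewrite linked-alongRun b i≤k same h = refl
...   | false = ⊥-elim (<-irrefl refl (≤-<-trans (subst (_≤ _) same (runStart≤ b i)) (s≤s i≤k)))

runStart≡0⇒linked : ∀ b k → runStart b k ≡ 0 → linked b k ≡ true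
runStart≡0⇒linked b k h = linked-alongRun b {0} {k} z≤n (sym h) refl

okAt-cycle : ∀ b k → linked b k ≡ true → b (dbl k) ≡ true → b (suc (dbl k)) ≡ true → okAt b k ≡ false
okAt-cycle b k p q s rewrite p | q | s = refl

okAt-isolated : ∀ b k → linked b k ≡ false → b (dbl k) ≡ false → okAt b k ≡ false
okAt-isolated b k p q rewrite p | q = refl

okAt-noRim : ∀ b k → b (dbl k) ≡ false → okAt b k ≡ linked b k
okAt-noRim b k a rewrite a = refl

okAt≡false : ∀ b k → okAt b k ≡ false →
  (linked b k ≡ true × b (dbl k) ≡ true × b (suc (dbl k)) ≡ true) ⊎ (linked b k ≡ false × b (dbl k) ≡ false)
okAt≡false b k h with linked b k | b (dbl k) | b (suc (dbl k))
... | true | true | true = inj₁ (refl , refl , refl)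
... | false | false | _ = inj₂ (refl , refl)

okAt-rim-unlinked : ∀ b k → b (dbl k) ≡ true → linked b k ≡ false → okAt b k ≡ true
okAt-rim-unlinked b k p q rewrite p | q = refl

okAt-rim-noSpoke : ∀ b k → b (dbl k) ≡ true → b (suc (dbl k)) ≡ false → okAt b k ≡ true
okAt-rim-noSpoke b k p q rewrite p | q = cong not (∧-zeroʳ (linked b k))

linked-suc-noRim : ∀ b k → b (dbl k) ≡ false → linked b (suc k) ≡ b (suc (dbl k))
linked-suc-noRim b k p rewrite p = refl

linked-suc-linkedRim : ∀ b k → linked b k ≡ true → b (dbl k) ≡ true → linked b (suc k) ≡ true
linked-suc-linkedRim b k σ p rewrite σ | p = refl

linked-suc-unlinkedRim : ∀ b k → linked b k ≡ false → b (dbl k) ≡ true → linked b (suc k) ≡ b (suc (dbl k))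
linked-suc-unlinkedRim b k σ p rewrite σ | p = refl

-- A spoke at k closes a cycle with the hub link of any vertex in the run ending at k + 2.
spoke-closesCycle : ∀ b {i k} → okAt b k ≡ true → b (suc (dbl k)) ≡ true → i ≤ k →
  runStart b i ≡ runStart b (suc k) → linked b i ≡ true → ⊥
spoke-closesCycle b {i} {k} ok spoke i≤k same linked-i = byRim (b (dbl k)) refl
  where
  byRim : ∀ x → b (dbl k) ≡ x → ⊥
  byRim true rim = true≢false (trans (sym ok) (okAt-cycle b k linked-k rim spoke))
    where
    linked-k : linked b k ≡ true
    linked-k = linked-alongRun b i≤k (trans same (runStart-extend b k rim)) linked-i
  byRim false rim = <⇒≱ (s≤s i≤k) (subst (_≤ i) restart (runStart≤ b i))
    where
    restart : runStart b i ≡ suc k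
    restart = trans same (runStart-restart b k rim)

-- The block of spoke w: the spoke 2w+1 together with the maximal run of passive rim elements 2j,
-- blockStart b w ≤ j ≤ w, directly below it.
blockStart : (ℕ → Bool) → ℕ → ℕ
blockStart b zero = 1
blockStart b (suc w) = if passive b (dbl (suc w)) then blockStart b w else suc (suc w)

InBlock′ : ℕ → ℕ → ℕ → Set
InBlock′ s w ℓ = ℓ ≡ suc (dbl w) ⊎ ∃[ j ] (ℓ ≡ dbl j × s ≤ j × j ≤ w)

InBlock : (ℕ → Bool) → ℕ → ℕ → Set
InBlock b w = InBlock′ (blockStart b w) w

blockMin : ℕ → ℕ → ℕ
blockMin s w with s ≤? w
... | yes _ = dbl s
... | no _ = suc (dbl w)

blockMin-inBlock : ∀ s w → InBlock′ s w (blockMin s w)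
blockMin-inBlock s w with s ≤? w
... | yes s≤w = inj₂ (s , refl , ≤-refl , s≤w)
... | no _ = inj₁ refl

¬passive-0 : ∀ b → passive b 0 ≡ false
¬passive-0 b with b 0
... | true = refl
... | false = refl

1≤blockStart : ∀ b w → 1 ≤ blockStart b w
1≤blockStart b zero = s≤s z≤n
1≤blockStart b (suc w) with passive b (dbl (suc w))
... | true = 1≤blockStart b w
... | false = s≤s z≤n

blockStart≤ : ∀ b w → blockStart b w ≤ suc w
blockStart≤ b zero = s≤s z≤n
blockStart≤ b (suc w) with passive b (dbl (suc w))
... | true = m≤n⇒m≤1+n (blockStart≤ b w)
... | false = ≤-refl

blockStart-run : ∀ b w j → blockStart b w ≤ j → j ≤ w → passive b (dbl j) ≡ true
blockStart-run b zero j 1≤j j≤0 = ⊥-elim (<-irrefl refl (≤-trans 1≤j j≤0))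
blockStart-run b (suc w) j start≤j j≤1+w with passive b (dbl (suc w)) in eq
... | false = ⊥-elim (<-irrefl refl (≤-trans start≤j j≤1+w))
... | true with m≤n⇒m<n∨m≡n j≤1+w
...   | inj₂ refl = eq
...   | inj₁ (s≤s j≤w) = blockStart-run b w j start≤j j≤w

blockStart-least : ∀ b w k → (∀ j → k ≤ j → j ≤ w → passive b (dbl j) ≡ true) → blockStart b w ≤ k
blockStart-least b zero zero run = contradiction (trans (sym (run 0 z≤n z≤n)) (¬passive-0 b)) true≢false
blockStart-least b zero (suc k) run = s≤s z≤n
blockStart-least b (suc w) k run with k ≤? suc w
... | no k≰1+w = ≤-trans (blockStart≤ b (suc w)) (≰⇒> k≰1+w)
... | yes k≤1+w with passive b (dbl (suc w)) in eq
...   | false = contradiction (trans (sym (run (suc w) k≤1+w ≤-refl)) eq) true≢false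
...   | true with m≤n⇒m<n∨m≡n k≤1+w
...     | inj₂ refl = blockStart≤ b w
...     | inj₁ (s≤s _) = blockStart-least b w k (λ j k≤j j≤w → run j k≤j (m≤n⇒m≤1+n j≤w))

blockStart-above : ∀ b w k → k ≤ w → passive b (dbl k) ≡ false → k < blockStart b w
blockStart-above b w k k≤w ¬passive with k <? blockStart b w
... | yes k<start = k<start
... | no k≮start = contradiction (trans (sym (blockStart-run b w k (≮⇒≥ k≮start) k≤w)) ¬passive) true≢false

hubStep≡false : ∀ {σ p q} → p ≡ true → hubStep σ p q ≡ false → σ ≡ false × q ≡ false
hubStep≡false {false} {true} {false} refl refl = refl , refl

module WellFormedCode (r : ℕ) (b : ℕ → Bool) (wf : WellFormed r b) (vanishes : VanishesFrom (dbl r) b) where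

  rim<r : ∀ k → b (dbl k) ≡ true → k < r
  rim<r k h with k <? r
  ... | yes k<r = k<r
  ... | no k≮r = contradiction (trans (sym h) (vanishes _ (dbl-mono-≤ (≮⇒≥ k≮r)))) true≢false

  spoke<r : ∀ k → b (suc (dbl k)) ≡ true → k < r
  spoke<r k h with k <? r
  ... | yes k<r = k<r
  ... | no k≮r = contradiction (trans (sym h) (vanishes _ (m≤n⇒m≤1+n (dbl-mono-≤ (≮⇒≥ k≮r))))) true≢false

  passive-rim-continues : ∀ k → passive b (dbl k) ≡ true →
    passive b (suc (dbl k)) ≡ true ⊎ passive b (dbl (suc k)) ≡ true
  passive-rim-continues k h with passive-rim⁻ b k h
  ... | rim , unlinked with b (suc (dbl k)) in spoke
  ...   | true = inj₁ (trans (passive-odd b k) spoke)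
  ...   | false = inj₂ (passive-rim⁺ b (suc k) next-rim unlinked′)
    where
    unlinked′ : linked b (suc k) ≡ false
    unlinked′ rewrite rim | unlinked | spoke = refl
    next-rim : b (dbl (suc k)) ≡ true
    next-rim with b (dbl (suc k)) in eq
    ... | true = refl
    ... | false = contradiction (trans (sym (wf (suc k) (rim<r k rim))) (okAt-isolated b (suc k) unlinked′ eq)) true≢false

  passive-rim-previous : ∀ k → passive b (dbl (suc k)) ≡ true → b (dbl k) ≡ true →
    passive b (dbl k) ≡ true × b (suc (dbl k)) ≡ false
  passive-rim-previous k h rim with hubStep≡false rim (proj₂ (passive-rim⁻ b (suc k) h))
  ... | unlinked , no-spoke = passive-rim⁺ b k rim unlinked , no-spoke

  rim-beforeSpoke-passive : ∀ w → b (suc (dbl w)) ≡ true → b (dbl w) ≡ true → passive b (dbl w) ≡ true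
  rim-beforeSpoke-passive w spoke rim with linked b w in eq
  ... | false = passive-rim⁺ b w rim eq
  ... | true = contradiction (trans (sym (wf w (<⇒≤ (spoke<r w spoke)))) (okAt-cycle b w eq rim spoke)) true≢false

  rim-afterSpoke-active : ∀ w → b (suc (dbl w)) ≡ true → passive b (dbl (suc w)) ≡ false
  rim-afterSpoke-active w h rewrite passive-even b (suc w) | linked-viaSpoke b w h = ∧-zeroʳ _

  passive-rim-reachesSpoke : ∀ k → passive b (dbl k) ≡ true →
    ∃[ w ] (k ≤ w × b (suc (dbl w)) ≡ true × (∀ j → k ≤ j → j ≤ w → passive b (dbl j) ≡ true))
  passive-rim-reachesSpoke k h = go (r ∸ k) k (m∸n+n≡m (<⇒≤ (rim<r k (proj₁ (passive-rim⁻ b k h))))) h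
    where
    go : ∀ d k → d + k ≡ r → passive b (dbl k) ≡ true →
      ∃[ w ] (k ≤ w × b (suc (dbl w)) ≡ true × (∀ j → k ≤ j → j ≤ w → passive b (dbl j) ≡ true))
    go zero k k≡r h = ⊥-elim (<-irrefl k≡r (rim<r k (proj₁ (passive-rim⁻ b k h))))
    go (suc d) k eq h with passive-rim-continues k h
    ... | inj₁ spoke = k , ≤-refl , trans (sym (passive-odd b k)) spoke ,
                       λ j k≤j j≤k → subst (λ t → passive b (dbl t) ≡ true) (≤-antisym k≤j j≤k) h
    ... | inj₂ next with go d (suc k) (trans (+-suc d k) eq) next
    ...   | w , 1+k≤w , spoke , run = w , ≤-trans (n≤1+n k) 1+k≤w , spoke , run′
      where
      run′ : ∀ j → k ≤ j → j ≤ w → passive b (dbl j) ≡ true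
      run′ j k≤j j≤w with m≤n⇒m<n∨m≡n k≤j
      ... | inj₂ refl = h
      ... | inj₁ k<j = run j k<j j≤w

  block-passive : ∀ w → b (suc (dbl w)) ≡ true → ∀ ℓ → InBlock b w ℓ → passive b ℓ ≡ true
  block-passive w spoke ℓ (inj₁ refl) = trans (passive-odd b w) spoke
  block-passive w spoke ℓ (inj₂ (j , refl , start≤j , j≤w)) = blockStart-run b w j start≤j j≤w

  passive-rim-inBlock : ∀ k → passive b (dbl k) ≡ true → ∃[ w ] (b (suc (dbl w)) ≡ true × InBlock b w (dbl k))
  passive-rim-inBlock k h with passive-rim-reachesSpoke k h
  ... | w , k≤w , spoke , run = w , spoke , inj₂ (k , refl , blockStart-least b w k run , k≤w)

  blocks-disjoint : ∀ w w′ j → b (suc (dbl w)) ≡ true → b (suc (dbl w′)) ≡ true →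
    blockStart b w ≤ j → j ≤ w → blockStart b w′ ≤ j → j ≤ w′ → w ≡ w′
  blocks-disjoint w w′ j spoke spoke′ s≤j j≤w s′≤j j≤w′ with <-cmp w w′
  ... | tri≈ _ w≡w′ _ = w≡w′
  ... | tri< w<w′ _ _ = contradiction (trans (sym (blockStart-run b w′ (suc w) (≤-trans s′≤j (m≤n⇒m≤1+n j≤w)) w<w′))
                                              (rim-afterSpoke-active w spoke)) true≢false
  ... | tri> _ _ w′<w = contradiction (trans (sym (blockStart-run b w (suc w′) (≤-trans s≤j (m≤n⇒m≤1+n j≤w′)) w′<w))
                                              (rim-afterSpoke-active w′ spoke′)) true≢false

  -- Passive rim elements propagate upwards until a spoke, so a passive least element forces the whole block.
  block-closed : ∀ s w → (∀ ℓ → passive b ℓ ≡ true → InBlock′ s w ℓ) → passive b (blockMin s w) ≡ true →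
    ∀ ℓ → InBlock′ s w ℓ → passive b ℓ ≡ true
  block-closed s w inBlock min-passive with s ≤? w
  ... | no s≰w = λ { ℓ (inj₁ refl) → min-passive ; ℓ (inj₂ (j , _ , s≤j , j≤w)) → ⊥-elim (s≰w (≤-trans s≤j j≤w)) }
  ... | yes s≤w = all
    where
    no-earlier-spoke : ∀ j → j < w → passive b (suc (dbl j)) ≢ true
    no-earlier-spoke j j<w h with inBlock _ h
    ... | inj₁ e = <-irrefl (dbl-injective (suc-injective e)) j<w
    ... | inj₂ (_ , e , _) = dbl≢1+dbl (sym e)
    no-later-rim : passive b (dbl (suc w)) ≢ true
    no-later-rim h with inBlock _ h
    ... | inj₁ e = dbl≢1+dbl e
    ... | inj₂ (_ , e , _ , j≤w) = <-irrefl refl (subst (_≤ w) (sym (dbl-injective e)) j≤w)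
    upTo : ∀ d j → s + d ≡ j → j ≤ w → passive b (dbl j) ≡ true
    upTo zero j refl _ = subst (λ t → passive b (dbl t) ≡ true) (sym (+-identityʳ s)) min-passive
    upTo (suc d) j eq j≤w with passive-rim-continues (s + d) (upTo d (s + d) refl (≤-trans (n≤1+n (s + d)) 1+s+d≤w))
      where 1+s+d≤w = subst (_≤ w) (trans (sym eq) (+-suc s d)) j≤w
    ... | inj₁ spoke = ⊥-elim (no-earlier-spoke (s + d) (subst (_≤ w) (trans (sym eq) (+-suc s d)) j≤w) spoke)
    ... | inj₂ next = subst (λ t → passive b (dbl t) ≡ true) (trans (sym (+-suc s d)) eq) next
    all : ∀ ℓ → InBlock′ s w ℓ → passive b ℓ ≡ true
    all ℓ (inj₂ (j , refl , s≤j , j≤w)) = upTo (j ∸ s) j (trans (+-comm s (j ∸ s)) (m∸n+n≡m s≤j)) j≤w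
    all ℓ (inj₁ refl) with passive-rim-continues w (upTo (w ∸ s) w (trans (+-comm s (w ∸ s)) (m∸n+n≡m s≤w)) ≤-refl)
    ... | inj₁ spoke = spoke
    ... | inj₂ next = ⊥-elim (no-later-rim next)

linked-constant : ∀ b a c → (∀ j → a ≤ j → j < c → b (dbl j) ≡ true × b (suc (dbl j)) ≡ false) → a ≤ c →
  linked b c ≡ linked b a
linked-constant b a zero h z≤n = refl
linked-constant b a (suc c) h a≤1+c with m≤n⇒m<n∨m≡n a≤1+c
... | inj₂ refl = refl
... | inj₁ (s≤s a≤c) with h c a≤c ≤-refl
...   | rim , no-spoke rewrite rim | no-spoke =
        trans (∨-identityʳ _) (linked-constant b a c (λ j a≤j j<c → h j a≤j (m≤n⇒m≤1+n j<c)) a≤c)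

linked-prefix : ∀ f f′ k → (∀ ℓ → ℓ < dbl k → f ℓ ≡ f′ ℓ) → linked f k ≡ linked f′ k
linked-prefix f f′ zero h = refl
linked-prefix f f′ (suc k) h
  rewrite h (dbl k) (dbl-mono-< (n<1+n k)) | h (suc (dbl k)) (n<1+n (suc (dbl k)))
        | linked-prefix f f′ k (λ ℓ ℓ< → h ℓ (<-trans ℓ< (dbl-mono-< (n<1+n k)))) = refl

linked-suffix : ∀ f f′ k₀ → (∀ ℓ → dbl k₀ ≤ ℓ → f ℓ ≡ f′ ℓ) → linked f k₀ ≡ linked f′ k₀ →
  ∀ k → k₀ ≤ k → linked f k ≡ linked f′ k
linked-suffix f f′ k₀ h e zero z≤n = e
linked-suffix f f′ k₀ h e (suc k) k₀≤1+k with m≤n⇒m<n∨m≡n k₀≤1+k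
... | inj₂ refl = e
... | inj₁ (s≤s k₀≤k)
  rewrite h (dbl k) (dbl-mono-≤ k₀≤k) | h (suc (dbl k)) (m≤n⇒m≤1+n (dbl-mono-≤ k₀≤k))
        | linked-suffix f f′ k₀ h e k k₀≤k = refl

okAt-agree : ∀ f f′ k → f (dbl k) ≡ f′ (dbl k) → f (suc (dbl k)) ≡ f′ (suc (dbl k)) →
  linked f k ≡ linked f′ k → okAt f k ≡ okAt f′ k
okAt-agree f f′ k a c d rewrite a | c | d = refl

-- The spanning tree whose passive set is exactly the block with start s of spoke w: every rim edge
-- except 2(s - 1), and the single spoke 2w + 1.
principalCode : ℕ → ℕ → ℕ → ℕ → Bool
principalCode r s w ℓ with parity ℓ
... | even k = does (k <? r) ∧ not (does (suc k ≟ℕ s))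
... | odd k = does (k ≟ℕ w)

module PrincipalCode (r s w : ℕ) (1≤s : 1 ≤ s) (s≤1+w : s ≤ suc w) (w<r : w < r) where
  p : ℕ → Bool
  p = principalCode r s w

  rim : ∀ k → p (dbl k) ≡ does (k <? r) ∧ not (does (suc k ≟ℕ s))
  rim k rewrite parity-even k = refl

  spoke : ∀ k → p (suc (dbl k)) ≡ does (k ≟ℕ w)
  spoke k rewrite parity-odd k = refl

  rim-present : ∀ k → k < r → suc k ≢ s → p (dbl k) ≡ true
  rim-present k k<r 1+k≢s rewrite rim k | dec-true (k <? r) k<r | dec-false (suc k ≟ℕ s) 1+k≢s = refl

  rim-absent : ∀ k → suc k ≡ s → p (dbl k) ≡ false
  rim-absent k 1+k≡s rewrite rim k | dec-true (suc k ≟ℕ s) 1+k≡s = ∧-zeroʳ _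

  spoke-present : p (suc (dbl w)) ≡ true
  spoke-present rewrite spoke w | dec-true (w ≟ℕ w) refl = refl

  spoke-absent : ∀ k → k ≢ w → p (suc (dbl k)) ≡ false
  spoke-absent k k≢w rewrite spoke k | dec-false (k ≟ℕ w) k≢w = refl

  vanishes : VanishesFrom (dbl r) p
  vanishes ℓ 2r≤ℓ with even-or-odd ℓ
  ... | inj₁ (k , refl) rewrite rim k | dec-false (k <? r) (λ k<r → <⇒≱ (dbl-mono-< k<r) 2r≤ℓ) = refl
  ... | inj₂ (k , refl) = spoke-absent k (λ { refl → <⇒≱ (<⇒1+dbl<dbl w<r) 2r≤ℓ })

  rimOnly : ∀ a k → a ≤ k → (∀ j → a ≤ j → j < k → j < r × suc j ≢ s × j ≢ w) → linked p k ≡ linked p a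
  rimOnly a k a≤k h = linked-constant p a k
    (λ j a≤j j<k → let (j<r , 1+j≢s , j≢w) = h j a≤j j<k in rim-present j j<r 1+j≢s , spoke-absent j j≢w) a≤k

  linked-beforeGap : ∀ k → k < s → linked p k ≡ true
  linked-beforeGap k k<s = rimOnly 0 k z≤n λ j _ j<k →
    <-≤-trans (<-trans j<k k<s) (≤-trans s≤1+w w<r) ,
    (λ { refl → <-irrefl refl (≤-trans k<s j<k) }) ,
    (λ { refl → <-irrefl refl (≤-trans (≤-trans (s≤s j<k) k<s) s≤1+w) })

  unlinked-inBlock : ∀ k → s ≤ k → k ≤ w → linked p k ≡ false
  unlinked-inBlock k s≤k k≤w = trans
    (rimOnly s k s≤k λ j s≤j j<k → <-≤-trans j<k (≤-trans k≤w (<⇒≤ w<r)) ,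
      (λ { refl → <-irrefl refl s≤j }) , (λ { refl → <-irrefl refl (≤-trans j<k k≤w) }))
    (unlinked-atStart s refl 1≤s)
    where
    unlinked-atStart : ∀ t → t ≡ s → 1 ≤ t → linked p t ≡ false
    unlinked-atStart (suc t) 1+t≡s _ = trans (linked-suc-noRim p t (rim-absent t 1+t≡s))
      (spoke-absent t (λ { refl → <-irrefl refl (subst (_≤ w) (sym 1+t≡s) (≤-trans s≤k k≤w)) }))

  linked-afterSpoke : ∀ k → w < k → k ≤ r → linked p k ≡ true
  linked-afterSpoke k w<k k≤r = trans
    (rimOnly (suc w) k w<k λ j w<j j<k → <-≤-trans j<k k≤r ,
      (λ { refl → <-irrefl refl (≤-trans (s≤s w<j) s≤1+w) }) , (λ { refl → <-irrefl refl w<j }))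
    (linked-viaSpoke p w spoke-present)

  wellFormed : WellFormed r p
  wellFormed k k≤r with m≤n⇒m<n∨m≡n k≤r
  ... | inj₂ refl = trans (okAt-noRim p k (vanishes (dbl k) ≤-refl)) (linked-afterSpoke k w<r ≤-refl)
  ... | inj₁ k<r with suc k ≟ℕ s
  ...   | yes 1+k≡s = trans (okAt-noRim p k (rim-absent k 1+k≡s)) (linked-beforeGap k (subst (k <_) 1+k≡s ≤-refl))
  ...   | no 1+k≢s with k ≟ℕ w
  ...     | yes refl = okAt-rim-unlinked p k (rim-present k k<r 1+k≢s)
                         (unlinked-inBlock k (≤-pred (≤∧≢⇒< s≤1+w (1+k≢s ∘ sym))) ≤-refl)
  ...     | no k≢w = okAt-rim-noSpoke p k (rim-present k k<r 1+k≢s) (spoke-absent k k≢w)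

  inBlock⇒passive : ∀ ℓ → InBlock′ s w ℓ → passive p ℓ ≡ true
  inBlock⇒passive ℓ (inj₁ refl) = trans (passive-odd p w) spoke-present
  inBlock⇒passive ℓ (inj₂ (j , refl , s≤j , j≤w)) =
    passive-rim⁺ p j (rim-present j (≤-<-trans j≤w w<r) (λ { refl → <-irrefl refl s≤j })) (unlinked-inBlock j s≤j j≤w)

  passive⇒inBlock : ∀ ℓ → passive p ℓ ≡ true → InBlock′ s w ℓ
  passive⇒inBlock ℓ h with even-or-odd ℓ
  ... | inj₂ (k , refl) with k ≟ℕ w
  ...   | yes refl = inj₁ refl
  ...   | no k≢w = contradiction (trans (sym (trans (sym (passive-odd p k)) h)) (spoke-absent k k≢w)) true≢false
  passive⇒inBlock ℓ h | inj₁ (k , refl) with p (dbl k) in present | linked p k in linked-k | trans (sym (passive-even p k)) h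
  ... | true | false | _ = inj₂ (k , refl , s≤k , k≤w)
    where
    k<r : k < r
    k<r with k <? r
    ... | yes k<r = k<r
    ... | no k≮r = contradiction (trans (sym present) (vanishes _ (dbl-mono-≤ (≮⇒≥ k≮r)))) true≢false
    s≤k : s ≤ k
    s≤k with s ≤? k
    ... | yes s≤k = s≤k
    ... | no s≰k = contradiction (trans (sym (linked-beforeGap k (≰⇒> s≰k))) linked-k) true≢false
    k≤w : k ≤ w
    k≤w with k ≤? w
    ... | yes k≤w = k≤w
    ... | no k≰w = contradiction (trans (sym (linked-afterSpoke k (≰⇒> k≰w) (<⇒≤ k<r))) linked-k) true≢false

update : (ℕ → Bool) → ℕ → ℕ → ℕ → Bool
update b A M ℓ = if does (ℓ ≟ℕ A) then true else if does (ℓ ≟ℕ M) then false else b ℓ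

module Update (b : ℕ → Bool) (A M : ℕ) (A≢M : A ≢ M) where
  R : ℕ → Bool
  R = update b A M

  R-added : R A ≡ true
  R-added rewrite dec-true (A ≟ℕ A) refl = refl

  R-removed : R M ≡ false
  R-removed rewrite dec-false (M ≟ℕ A) (A≢M ∘ sym) | dec-true (M ≟ℕ M) refl = refl

  R-unchanged : ∀ ℓ → ℓ ≢ A → ℓ ≢ M → R ℓ ≡ b ℓ
  R-unchanged ℓ ℓ≢A ℓ≢M rewrite dec-false (ℓ ≟ℕ A) ℓ≢A | dec-false (ℓ ≟ℕ M) ℓ≢M = refl

record Reduct (r : ℕ) (b : ℕ → Bool) (m : ℕ) : Set where
  field
    code : ℕ → Bool
    wellFormed : WellFormed r code
    vanishes : VanishesFrom (dbl r) code
    drops : passive code m ≡ false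
    keeps : ∀ ℓ → ℓ ≢ m → passive code ℓ ≡ passive b ℓ

-- Removing the least element of the block of a spoke from the passive set, and nothing else, by a
-- single exchange: the rim edge just below the block comes in and the block minimum goes out.
module Reduction (r : ℕ) (b : ℕ → Bool) (wf : WellFormed r b) (vanishes : VanishesFrom (dbl r) b)
                 (w : ℕ) (spoke : b (suc (dbl w)) ≡ true) where
  open WellFormedCode r b wf vanishes

  w<r : w < r
  w<r = spoke<r w spoke

  module ReduceRim (s′ : ℕ) (start≡ : blockStart b w ≡ suc s′) (1+s′≤w : suc s′ ≤ w) where
    s : ℕ
    s = suc s′

    passive-s : passive b (dbl s) ≡ true
    passive-s = blockStart-run b w s (≤-reflexive start≡) 1+s′≤w

    unlinked-s : linked b s ≡ false
    unlinked-s = proj₂ (passive-rim⁻ b s passive-s)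

    rim-s′-absent : b (dbl s′) ≡ false
    rim-s′-absent with b (dbl s′) in rim-s′
    ... | false = refl
    ... | true = ⊥-elim (<-irrefl refl (subst (_≤ s′) start≡ (blockStart-least b w s′ run)))
      where
      run : ∀ j → s′ ≤ j → j ≤ w → passive b (dbl j) ≡ true
      run j s′≤j j≤w with m≤n⇒m<n∨m≡n s′≤j
      ... | inj₂ refl = proj₁ (passive-rim-previous s′ passive-s rim-s′)
      ... | inj₁ s′<j = blockStart-run b w j (≤-trans (≤-reflexive start≡) s′<j) j≤w

    linked-s′ : linked b s′ ≡ true
    linked-s′ = trans (sym (okAt-noRim b s′ rim-s′-absent)) (wf s′ (<⇒≤ (<-trans 1+s′≤w w<r)))

    open Update b (dbl s′) (dbl s) (λ e → <-irrefl (dbl-injective e) (n<1+n s′)) public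

    R-spoke : ∀ k → R (suc (dbl k)) ≡ b (suc (dbl k))
    R-spoke k = R-unchanged _ (dbl≢1+dbl ∘ sym) (dbl≢1+dbl ∘ sym)

    linked-below : ∀ k → k ≤ s′ → linked R k ≡ linked b k
    linked-below k k≤s′ = linked-prefix R b k λ ℓ ℓ<2k →
      R-unchanged ℓ (λ { refl → <-irrefl refl (<-≤-trans ℓ<2k (dbl-mono-≤ k≤s′)) })
                    (λ { refl → <-irrefl refl (<-≤-trans ℓ<2k (dbl-mono-≤ (m≤n⇒m≤1+n k≤s′))) })

    linked-R-s : linked R s ≡ true
    linked-R-s = linked-suc-linkedRim R s′ (trans (linked-below s′ ≤-refl) linked-s′) R-added

    linked-above : ∀ k → suc s ≤ k → linked R k ≡ linked b k
    linked-above = linked-suffix R b (suc s)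
      (λ ℓ 2+2s≤ℓ → R-unchanged ℓ (λ { refl → <⇒≱ (dbl-mono-< (<-trans (n<1+n s′) (n<1+n s))) 2+2s≤ℓ })
                                  (λ { refl → <⇒≱ (dbl-mono-< (n<1+n s)) 2+2s≤ℓ }))
      (begin
        linked R (suc s)       ≡⟨ linked-suc-noRim R s R-removed ⟩
        R (suc (dbl s))        ≡⟨ R-spoke s ⟩
        b (suc (dbl s))        ≡⟨ linked-suc-unlinkedRim b s unlinked-s (proj₁ (passive-rim⁻ b s passive-s)) ⟨
        linked b (suc s)       ∎)
      where open ≡-Reasoning

    linked-agree : ∀ k → k ≢ s → linked R k ≡ linked b k
    linked-agree k k≢s with k ≤? s′
    ... | yes k≤s′ = linked-below k k≤s′
    ... | no k≰s′ = linked-above k (≤∧≢⇒< (≰⇒> k≰s′) (k≢s ∘ sym))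

    keeps : ∀ ℓ → ℓ ≢ dbl s → passive R ℓ ≡ passive b ℓ
    keeps ℓ ℓ≢2s with even-or-odd ℓ
    ... | inj₂ (k , refl) = trans (passive-odd R k) (trans (R-spoke k) (sym (passive-odd b k)))
    ... | inj₁ (k , refl) with k ≟ℕ s′
    ...   | yes refl rewrite passive-even R s′ | passive-even b s′ | R-added | linked-below s′ ≤-refl
                           | linked-s′ | rim-s′-absent = refl
    ...   | no k≢s′ rewrite passive-even R k | passive-even b k
                          | R-unchanged (dbl k) (k≢s′ ∘ dbl-injective) ℓ≢2s | linked-agree k (ℓ≢2s ∘ cong dbl) = refl

    wellFormed : WellFormed r R
    wellFormed k k≤r with k ≟ℕ s′
    ... | yes refl = okAt-rim-noSpoke R s′ R-added
                       (trans (R-spoke s′) (trans (sym (linked-suc-noRim b s′ rim-s′-absent)) unlinked-s))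
    ... | no k≢s′ with k ≟ℕ s
    ...   | yes refl = trans (okAt-noRim R s R-removed) linked-R-s
    ...   | no k≢s = trans (okAt-agree R b k (R-unchanged _ (k≢s′ ∘ dbl-injective) (k≢s ∘ dbl-injective))
                                              (R-spoke k) (linked-agree k k≢s)) (wf k k≤r)

    reduct : Reduct r b (dbl s)
    reduct = record
      { code = R
      ; wellFormed = wellFormed
      ; vanishes = λ ℓ 2r≤ℓ → case-removed ℓ 2r≤ℓ
      ; drops = ∉⇒¬passive R (dbl s) R-removed
      ; keeps = keeps
      }
      where
      case-removed : ∀ ℓ → dbl r ≤ ℓ → R ℓ ≡ false
      case-removed ℓ 2r≤ℓ with ℓ ≟ℕ dbl s
      ... | yes refl = R-removed
      ... | no ℓ≢2s = trans (R-unchanged ℓ (λ { refl → <⇒≱ (dbl-mono-< (<-trans 1+s′≤w w<r)) 2r≤ℓ }) ℓ≢2s) (vanishes ℓ 2r≤ℓ)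

  module ReduceSpoke (start≡ : blockStart b w ≡ suc w) where
    rim-w-absent : b (dbl w) ≡ false
    rim-w-absent with b (dbl w) in rim-w
    ... | false = refl
    ... | true = ⊥-elim (<-irrefl refl (subst (_≤ w) start≡ (blockStart-least b w w
                   (λ j w≤j j≤w → subst (λ t → passive b (dbl t) ≡ true) (≤-antisym w≤j j≤w)
                                    (rim-beforeSpoke-passive w spoke rim-w)))))

    linked-w : linked b w ≡ true
    linked-w = trans (sym (okAt-noRim b w rim-w-absent)) (wf w (<⇒≤ w<r))

    open Update b (dbl w) (suc (dbl w)) dbl≢1+dbl public

    linked-below : ∀ k → k ≤ w → linked R k ≡ linked b k
    linked-below k k≤w = linked-prefix R b k λ ℓ ℓ<2k →
      R-unchanged ℓ (λ { refl → <-irrefl refl (<-≤-trans ℓ<2k (dbl-mono-≤ k≤w)) })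
                    (λ { refl → <-irrefl refl (<-trans (<-≤-trans ℓ<2k (dbl-mono-≤ k≤w)) (n<1+n _)) })

    linked-agree : ∀ k → linked R k ≡ linked b k
    linked-agree k with k ≤? w
    ... | yes k≤w = linked-below k k≤w
    ... | no k≰w = linked-suffix R b (suc w)
        (λ ℓ 2+2w≤ℓ → R-unchanged ℓ (λ { refl → <⇒≱ (dbl-mono-< (n<1+n w)) 2+2w≤ℓ })
                                    (λ { refl → <⇒≱ (n<1+n (suc (dbl w))) 2+2w≤ℓ }))
        (trans (linked-suc-linkedRim R w (trans (linked-below w ≤-refl) linked-w) R-added)
               (sym (linked-viaSpoke b w spoke)))
        k (≰⇒> k≰w)

    keeps : ∀ ℓ → ℓ ≢ suc (dbl w) → passive R ℓ ≡ passive b ℓ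
    keeps ℓ ℓ≢2w+1 with even-or-odd ℓ
    ... | inj₂ (k , refl) = trans (passive-odd R k) (trans (R-unchanged _ (dbl≢1+dbl ∘ sym) ℓ≢2w+1) (sym (passive-odd b k)))
    ... | inj₁ (k , refl) with k ≟ℕ w
    ...   | yes refl rewrite passive-even R w | passive-even b w | R-added | linked-agree w
                           | linked-w | rim-w-absent = refl
    ...   | no k≢w rewrite passive-even R k | passive-even b k
                         | R-unchanged (dbl k) (k≢w ∘ dbl-injective) dbl≢1+dbl | linked-agree k = refl

    wellFormed : WellFormed r R
    wellFormed k k≤r with k ≟ℕ w
    ... | yes refl = okAt-rim-noSpoke R w R-added R-removed
    ... | no k≢w = trans (okAt-agree R b k (R-unchanged _ (k≢w ∘ dbl-injective) dbl≢1+dbl)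
                                           (R-unchanged _ (dbl≢1+dbl ∘ sym) (k≢w ∘ dbl-injective ∘ suc-injective))
                                           (linked-agree k))
                         (wf k k≤r)

    reduct : Reduct r b (suc (dbl w))
    reduct = record
      { code = R
      ; wellFormed = wellFormed
      ; vanishes = case-removed
      ; drops = trans (passive-odd R w) R-removed
      ; keeps = keeps
      }
      where
      case-removed : ∀ ℓ → dbl r ≤ ℓ → R ℓ ≡ false
      case-removed ℓ 2r≤ℓ with ℓ ≟ℕ suc (dbl w)
      ... | yes refl = R-removed
      ... | no ℓ≢2w+1 = trans (R-unchanged ℓ (λ { refl → <⇒≱ (dbl-mono-< w<r) 2r≤ℓ }) ℓ≢2w+1) (vanishes ℓ 2r≤ℓ)

  reduce : Reduct r b (blockMin (blockStart b w) w)
  reduce with blockStart b w ≤? w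
  ... | no start≰w = ReduceSpoke.reduct (≤-antisym (blockStart≤ b w) (≰⇒> start≰w))
  ... | yes start≤w = byStart (blockStart b w) refl start≤w
    where
    byStart : ∀ t → blockStart b w ≡ t → t ≤ w → Reduct r b (dbl t)
    byStart zero start≡0 _ = ⊥-elim (<-irrefl refl (subst (1 ≤_) start≡0 (1≤blockStart b w)))
    byStart (suc s′) start≡ 1+s′≤w = ReduceRim.reduct s′ start≡ 1+s′≤w

-- Knowing whether rim vertex k + 1 is linked to the hub and whether the spoke 2k + 1 is present,
-- the rim edge 2k is recovered from the passivity of 2k and 2k + 2.
rimFromPassive : Bool → Bool → Bool → Bool → Bool
rimFromPassive true spoke p₀ p₂ = not spoke ∧ not p₂
rimFromPassive false spoke p₀ p₂ = p₀

rim-fromPassive : ∀ r b → WellFormed r b → ∀ k → k < r →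
  b (dbl k) ≡ rimFromPassive (linked b k) (b (suc (dbl k))) (passive b (dbl k)) (passive b (dbl (suc k)))
rim-fromPassive r b wf k k<r rewrite passive-even b k | passive-even b (suc k) with linked b k in linked-k
... | false with b (dbl k)
...   | true = refl
...   | false = refl
rim-fromPassive r b wf k k<r | true with b (suc (dbl k)) in spoke
... | true with b (dbl k) in rim
...   | false = refl
...   | true = contradiction (trans (sym (wf k (<⇒≤ k<r))) (okAt-cycle b k linked-k rim spoke)) true≢false
rim-fromPassive r b wf k k<r | true | false with b (dbl k) in rim
... | true with b (dbl (suc k))
...   | true = refl
...   | false = refl
rim-fromPassive r b wf k k<r | true | false | false = sym (cong (λ x → not (x ∧ true)) next-rim)
  where
  unlinked : linked b (suc k) ≡ false
  unlinked = trans (linked-suc-noRim b k rim) spoke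
  next-rim : b (dbl (suc k)) ≡ true
  next-rim with b (dbl (suc k)) in eq
  ... | true = refl
  ... | false = contradiction (trans (sym (wf (suc k) k<r)) (okAt-isolated b (suc k) unlinked eq)) true≢false

passive-injective : ∀ r b b′ → WellFormed r b → WellFormed r b′ → VanishesFrom (dbl r) b → VanishesFrom (dbl r) b′ →
  passive b ≗ passive b′ → b ≗ b′
passive-injective r b b′ wf wf′ vanishes vanishes′ same ℓ = below (suc ℓ) ℓ (ℓ<2+2ℓ ℓ)
  where
  ℓ<2+2ℓ : ∀ ℓ → ℓ < dbl (suc ℓ)
  ℓ<2+2ℓ zero = s≤s z≤n
  ℓ<2+2ℓ (suc ℓ) = s≤s (<-trans (ℓ<2+2ℓ ℓ) (n<1+n _))
  spokes : ∀ k → b (suc (dbl k)) ≡ b′ (suc (dbl k))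
  spokes k = trans (sym (passive-odd b k)) (trans (same (suc (dbl k))) (passive-odd b′ k))
  below : ∀ k ℓ → ℓ < dbl k → b ℓ ≡ b′ ℓ
  below (suc k) ℓ ℓ<2+2k with m≤n⇒m<n∨m≡n (≤-pred ℓ<2+2k)
  ... | inj₂ refl = spokes k
  ... | inj₁ ℓ<1+2k with m≤n⇒m<n∨m≡n (≤-pred ℓ<1+2k)
  ...   | inj₁ ℓ<2k = below k ℓ ℓ<2k
  ...   | inj₂ refl with k <? r
  ...     | no k≮r = trans (vanishes _ (dbl-mono-≤ (≮⇒≥ k≮r))) (sym (vanishes′ _ (dbl-mono-≤ (≮⇒≥ k≮r))))
  ...     | yes k<r = begin
    b (dbl k)
      ≡⟨ rim-fromPassive r b wf k k<r ⟩
    rimFromPassive (linked b k) (b (suc (dbl k))) (passive b (dbl k)) (passive b (dbl (suc k)))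
      ≡⟨ cong₂ (λ σ q → rimFromPassive σ q _ _) (linked-prefix b b′ k (below k)) (spokes k) ⟩
    rimFromPassive (linked b′ k) (b′ (suc (dbl k))) (passive b (dbl k)) (passive b (dbl (suc k)))
      ≡⟨ cong₂ (rimFromPassive (linked b′ k) (b′ (suc (dbl k)))) (same (dbl k)) (same (dbl (suc k))) ⟩
    rimFromPassive (linked b′ k) (b′ (suc (dbl k))) (passive b′ (dbl k)) (passive b′ (dbl (suc k)))
      ≡⟨ rim-fromPassive r b′ wf′ k k<r ⟨
    b′ (dbl k) ∎
    where open ≡-Reasoning

-- The cycle matroid of the fan

fanEdge : ℕ → ℕ × ℕ
fanEdge ℓ with parity ℓ
... | even k = (suc k , suc (suc k))
... | odd k = (1 , suc (suc k))

fanEdge-rim : ∀ k → fanEdge (dbl k) ≡ (suc k , suc (suc k))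
fanEdge-rim k rewrite parity-even k = refl

fanEdge-spoke : ∀ k → fanEdge (suc (dbl k)) ≡ (1 , suc (suc k))
fanEdge-spoke k rewrite parity-odd k = refl

lookup-∷ʳ : ∀ {A : Set} {m} (xs : Vec A m) (x : A) (f : ℕ → A) → (∀ i → lookup xs i ≡ f (toℕ i)) →
  f m ≡ x → ∀ i → lookup (xs ∷ʳ x) i ≡ f (toℕ i)
lookup-∷ʳ [] x f h fm≡x zero = sym fm≡x
lookup-∷ʳ (y ∷ ys) x f h fm≡x zero = h zero
lookup-∷ʳ (y ∷ ys) x f h fm≡x (suc i) = lookup-∷ʳ ys x (f ∘ suc) (h ∘ suc) fm≡x i

lookup-edgesG : ∀ r i → lookup (edgesG r) i ≡ fanEdge (toℕ i)
lookup-edgesG (suc zero) zero = refl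
lookup-edgesG (suc zero) (suc zero) = refl
lookup-edgesG (suc (suc r)) =
  lookup-∷ʳ (edgesG (suc r) ∷ʳ (2 + r , 3 + r)) _ fanEdge
    (lookup-∷ʳ (edgesG (suc r)) _ fanEdge (lookup-edgesG (suc r)) (fanEdge-rim (suc r)))
    (fanEdge-spoke (suc r))

indicator : ∀ {m} → Vec Bool m → ℕ → Bool
indicator [] _ = false
indicator (x ∷ xs) zero = x
indicator (x ∷ xs) (suc ℓ) = indicator xs ℓ

indicator-lookup : ∀ {m} (S : Vec Bool m) i → indicator S (toℕ i) ≡ lookup S i
indicator-lookup (x ∷ S) zero = refl
indicator-lookup (x ∷ S) (suc i) = indicator-lookup S i

indicator-vanishes : ∀ {m} (S : Vec Bool m) → VanishesFrom m (indicator S)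
indicator-vanishes [] ℓ _ = refl
indicator-vanishes (x ∷ S) (suc ℓ) (s≤s m≤ℓ) = indicator-vanishes S ℓ m≤ℓ

indicator-index : ∀ {m} (S : Vec Bool m) ℓ → indicator S ℓ ≡ true → ∃[ i ] toℕ {m} i ≡ ℓ
indicator-index (x ∷ S) zero h = zero , refl
indicator-index (x ∷ S) (suc ℓ) h with indicator-index S ℓ h
... | i , toℕi≡ℓ = suc i , cong suc toℕi≡ℓ

indicator-injective : ∀ {m} {X Y : Vec Bool m} → indicator X ≗ indicator Y → X ≡ Y
indicator-injective {X = []} {[]} _ = refl
indicator-injective {X = x ∷ X} {y ∷ Y} h = cong₂ _∷_ (h 0) (indicator-injective (h ∘ suc))

indicator-tabulate : ∀ m f → VanishesFrom m f → indicator (tabulate {n = m} (f ∘ toℕ)) ≗ f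
indicator-tabulate zero f vanishes ℓ = sym (vanishes ℓ z≤n)
indicator-tabulate (suc m) f vanishes zero = refl
indicator-tabulate (suc m) f vanishes (suc ℓ) =
  indicator-tabulate m (f ∘ suc) (λ ℓ′ m≤ℓ′ → vanishes (suc ℓ′) (s≤s m≤ℓ′)) ℓ

does-⇔ : ∀ {P Q : Set} (p? : Dec P) (q? : Dec Q) → (P → Q) → (Q → P) → does p? ≡ does q?
does-⇔ (yes p) (yes q) f g = refl
does-⇔ (no ¬p) (no ¬q) f g = refl
does-⇔ (yes p) (no ¬q) f g = contradiction (f p) ¬q
does-⇔ (no ¬p) (yes q) f g = contradiction (g q) ¬p

does-¬¬ : ∀ {P Q : Set} (p? : Dec P) (q? : Dec Q) → ¬ P → ¬ Q → does p? ≡ does q?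
does-¬¬ p? q? ¬p ¬q = does-⇔ p? q? (⊥-elim ∘ ¬p) (⊥-elim ∘ ¬q)

does-≢ : ∀ {P Q : Set} (p? : Dec P) (q? : Dec Q) → P → ¬ Q → does p? ≢ does q?
does-≢ (yes p) (no ¬q) _ _ ()
does-≢ (yes p) (yes q) _ ¬q _ = ¬q q
does-≢ (no ¬p) _ p _ _ = ¬p p

module FanMatroid (r : ℕ) where
  n : ℕ
  n = dbl r

  open CycleMatroid (edgesG r) public
  open CycleMatroidFacts (edgesG r) public

  ends-rim : ∀ i {k} → toℕ i ≡ dbl k → source i ≡ suc k × target i ≡ suc (suc k)
  ends-rim i {k} i≡2k = cong proj₁ ends , cong proj₂ ends
    where
    ends : lookup (edgesG r) i ≡ (suc k , suc (suc k))
    ends = trans (lookup-edgesG r i) (trans (cong fanEdge i≡2k) (fanEdge-rim k))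

  ends-spoke : ∀ i {k} → toℕ i ≡ suc (dbl k) → source i ≡ 1 × target i ≡ suc (suc k)
  ends-spoke i {k} i≡2k+1 = cong proj₁ ends , cong proj₂ ends
    where
    ends : lookup (edgesG r) i ≡ (1 , suc (suc k))
    ends = trans (lookup-edgesG r i) (trans (cong fanEdge i≡2k+1) (fanEdge-spoke k))

  Joins-rim : ∀ i {k} → toℕ i ≡ dbl k → Joins i (suc k) (suc (suc k))
  Joins-rim i i≡2k = inj₁ (ends-rim i i≡2k)

  Joins-spoke : ∀ i {k} → toℕ i ≡ suc (dbl k) → Joins i 1 (suc (suc k))
  Joins-spoke i i≡2k+1 = inj₁ (ends-spoke i i≡2k+1)

  Vertex : ℕ → Set
  Vertex x = 1 ≤ x × x ≤ suc r

  ends-vertices : ∀ j → Vertex (source j) × Vertex (target j)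
  ends-vertices j with even-or-odd (toℕ j)
  ... | inj₁ (k , j≡2k) =
    let (p , q) = ends-rim j j≡2k
        k<r = dbl-cancel-< (subst (_< n) j≡2k (Finₚ.toℕ<n j)) in
    subst Vertex (sym p) (s≤s z≤n , s≤s (<⇒≤ k<r)) , subst Vertex (sym q) (s≤s z≤n , s≤s k<r)
  ... | inj₂ (k , j≡2k+1) =
    let (p , q) = ends-spoke j j≡2k+1
        k<r = 1+dbl<dbl⇒< (subst (_< n) j≡2k+1 (Finₚ.toℕ<n j)) in
    subst Vertex (sym p) (s≤s z≤n , s≤s z≤n) , subst Vertex (sym q) (s≤s z≤n , s≤s k<r)

  open Spanning 1 Vertex ends-vertices public

  element : ∀ ℓ → ℓ < n → ∃[ i ] toℕ i ≡ ℓ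
  element ℓ ℓ<n = fromℕ< ℓ<n , Finₚ.toℕ-fromℕ< ℓ<n

  -- Vertex x sits at position x - 1 of a code, so its run of rim edges starts at runStart b (pred x).
  colour : {Side : ℕ → Set} → (∀ x → Dec (Side x)) → ℕ → Bool
  colour side? x = does (side? x)

  module Code (S : Subset n) where
    b : ℕ → Bool
    b = indicator S

    vanishes : VanishesFrom n b
    vanishes = indicator-vanishes S

    ∈⇒code : ∀ {i} → i ∈ S → b (toℕ i) ≡ true
    ∈⇒code {i} i∈S = trans (indicator-lookup S i) ([]=⇒lookup i∈S)

    code⇒∈ : ∀ {i} → b (toℕ i) ≡ true → i ∈ S
    code⇒∈ {i} h = lookup⇒[]= i S (trans (sym (indicator-lookup S i)) h)

    code⇒< : ∀ ℓ → b ℓ ≡ true → ℓ < n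
    code⇒< ℓ h with ℓ <? n
    ... | yes ℓ<n = ℓ<n
    ... | no ℓ≮n = ⊥-elim (true≢false (trans (sym h) (vanishes ℓ (≮⇒≥ ℓ≮n))))

    elementAt : ∀ ℓ → b ℓ ≡ true → ∃[ i ] (toℕ i ≡ ℓ × i ∈ S)
    elementAt ℓ h with indicator-index S ℓ h
    ... | i , i≡ℓ = i , i≡ℓ , code⇒∈ (trans (cong b i≡ℓ) h)

    rim<r : ∀ k → b (dbl k) ≡ true → k < r
    rim<r k h = dbl-cancel-< (code⇒< _ h)

    spoke<r : ∀ k → b (suc (dbl k)) ≡ true → k < r
    spoke<r k h = 1+dbl<dbl⇒< (code⇒< _ h)

    ∈S-e : ∀ e i → i ∈ S - e → i ∈ S × toℕ i ≢ toℕ e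
    ∈S-e e i i∈ = x∈p-y⇒x∈p i∈ , x∈p-y⇒x≢y i∈ ∘ Finₚ.toℕ-injective

    hubWalk : ∀ k → linked b k ≡ true → (T : Subset n) → (∀ i → toℕ i < dbl k → i ∈ S → i ∈ T) →
      Reach T 1 (suc k)
    hubWalk zero _ T _ = here
    hubWalk (suc k) linked-k T below⊆T with b (suc (dbl k)) in spoke
    ... | true = let (i , i≡ , i∈) = elementAt _ spoke in
                 step i (below⊆T i (subst (_< dbl (suc k)) (sym i≡) (n<1+n _)) i∈) (Joins-spoke i i≡) here
    ... | false with b (dbl k) in rim
    ...   | true = let (i , i≡ , i∈) = elementAt _ rim in
                   Reach-trans
                     (hubWalk k (trans (sym (∨-identityʳ _)) linked-k) T
                       (λ j j< j∈ → below⊆T j (<-trans j< (dbl-mono-< (n<1+n k))) j∈))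
                     (step i (below⊆T i (subst (_< dbl (suc k)) (sym i≡) (dbl-mono-< (n<1+n k))) i∈) (Joins-rim i i≡) here)
    ...   | false = ⊥-elim (true≢false (sym linked-k))

    hubCycle : ∀ k → linked b k ≡ true → ∀ {i j} → toℕ i ≡ suc (dbl k) → toℕ j ≡ dbl k → j ∈ S →
      Reach (S - i) 1 (suc (suc k))
    hubCycle k linked-k {i} {j} i≡ j≡ j∈S =
      Reach-trans (hubWalk k linked-k (S - i) below⊆)
        (step j (x∈p∧x≢y⇒x∈p-y j∈S (λ j≡i → dbl≢1+dbl (trans (sym j≡) (trans (cong toℕ j≡i) i≡)))) (Joins-rim j j≡) here)
      where
      below⊆ : ∀ x → toℕ x < dbl k → x ∈ S → x ∈ S - i
      below⊆ x x<2k x∈S =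
        x∈p∧x≢y⇒x∈p-y x∈S (λ x≡i → <⇒≱ x<2k (subst (dbl k ≤_) (sym (trans (cong toℕ x≡i) i≡)) (n≤1+n _)))

    Respects-byKind : (T : Subset n) (Ok : ℕ → Set) (c : ℕ → Bool) → (∀ i → i ∈ T → i ∈ S × Ok (toℕ i)) →
      (∀ k → b (dbl k) ≡ true → Ok (dbl k) → c (suc k) ≡ c (suc (suc k))) →
      (∀ k → b (suc (dbl k)) ≡ true → Ok (suc (dbl k)) → c 1 ≡ c (suc (suc k))) → Respects T c
    Respects-byKind T Ok c T⊆ rims spokes i i∈T with T⊆ i i∈T | even-or-odd (toℕ i)
    ... | i∈S , ok | inj₁ (k , i≡) = let (p , q) = ends-rim i i≡ in
      trans (cong c p) (trans (rims k (trans (cong b (sym i≡)) (∈⇒code i∈S)) (subst Ok i≡ ok)) (cong c (sym q)))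
    ... | i∈S , ok | inj₂ (k , i≡) = let (p , q) = ends-spoke i i≡ in
      trans (cong c p) (trans (spokes k (trans (cong b (sym i≡)) (∈⇒code i∈S)) (subst Ok i≡ ok)) (cong c (sym q)))

    crosses-rim : ∀ {c i k} → toℕ i ≡ dbl k → c (suc k) ≢ c (suc (suc k)) → Crosses i c
    crosses-rim {c} {i} i≡ c≢ h = c≢ (trans (cong c (sym (proj₁ (ends-rim i i≡)))) (trans h (cong c (proj₂ (ends-rim i i≡)))))

    crosses-spoke : ∀ {c i k} → toℕ i ≡ suc (dbl k) → c 1 ≢ c (suc (suc k)) → Crosses i c
    crosses-spoke {c} {i} i≡ c≢ h =
      c≢ (trans (cong c (sym (proj₁ (ends-spoke i i≡)))) (trans h (cong c (proj₂ (ends-spoke i i≡)))))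

    module OfWellFormed (wf : WellFormed r b) where

      reachHub : ∀ d k → d + k ≡ r → Reach S (suc k) 1
      reachHub d k d+k≡r with linked b k in linked-k
      ... | true = Reach-sym (hubWalk k linked-k S (λ _ _ i∈S → i∈S))
      reachHub zero k refl | false =
        ⊥-elim (true≢false (trans (sym (wf k ≤-refl)) (okAt-isolated b k linked-k (vanishes (dbl k) ≤-refl))))
      reachHub (suc d) k d+k≡r | false with b (dbl k) in rim
      ... | false = ⊥-elim (true≢false (trans (sym (wf k (subst (k ≤_) d+k≡r (m≤n+m k (suc d))))) (okAt-isolated b k linked-k rim)))
      ... | true = let (i , i≡ , i∈) = elementAt _ rim in
                   step i i∈ (Joins-rim i i≡) (reachHub d (suc k) (trans (+-suc d k) d+k≡r))

      connected : Connected S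
      connected (suc k) (_ , s≤s k≤r) = reachHub (r ∸ k) k (m∸n+n≡m k≤r)

      -- Cutting a linked rim edge 2m separates the run of vertices above it; every edge crossing that cut
      -- is at least 2m.
      module ActiveRim (e : Fin n) (m : ℕ) (e≡ : toℕ e ≡ dbl m) (rim : b (dbl m) ≡ true) (linked-m : linked b m ≡ true) where
        Side : ℕ → Set
        Side x = suc (suc m) ≤ x × runStart b (pred x) ≡ runStart b (suc m)

        side? : ∀ x → Dec (Side x)
        side? x = (suc (suc m) ≤? x) ×-dec (runStart b (pred x) ≟ℕ runStart b (suc m))

        c : ℕ → Bool
        c = colour side?

        respects : Respects (S - e) c
        respects = Respects-byKind (S - e) (_≢ toℕ e) c (∈S-e e) rims spokes
          where
          rims : ∀ k → b (dbl k) ≡ true → dbl k ≢ toℕ e → c (suc k) ≡ c (suc (suc k))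
          rims k rim-k 2k≢e = does-⇔ (side? (suc k)) (side? (suc (suc k)))
            (λ (m+2≤ , same) → m≤n⇒m≤1+n m+2≤ , trans (runStart-extend b k rim-k) same)
            (λ (m+2≤ , same) → ≤∧≢⇒< (≤-pred m+2≤) (λ m+1≡k+1 → 2k≢e (trans (cong dbl (sym (suc-injective m+1≡k+1))) (sym e≡))) ,
                               trans (sym (runStart-extend b k rim-k)) same)
          spokes : ∀ k → b (suc (dbl k)) ≡ true → suc (dbl k) ≢ toℕ e → c 1 ≡ c (suc (suc k))
          spokes k spoke _ = does-¬¬ (side? 1) (side? (suc (suc k))) (λ { (s≤s () , _) })
            (λ (m+2≤ , same) → spoke-closesCycle b {m} {k} (wf k (<⇒≤ (spoke<r k spoke))) spoke (≤-pred (≤-pred m+2≤))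
                                 (trans (sym (runStart-extend b m rim)) (sym same)) linked-m)

        crosses : Crosses e c
        crosses = crosses-rim {c} e≡ (does-≢ (side? (suc (suc m))) (side? (suc m)) (≤-refl , refl) (λ (m+2≤m+1 , _) → <-irrefl refl m+2≤m+1) ∘ sym)

        least : ∀ x → Crosses x c → toℕ e ≤ toℕ x
        least x x-crosses with toℕ e ≤? toℕ x
        ... | yes e≤x = e≤x
        ... | no e≰x = ⊥-elim (x-crosses (byKind (even-or-odd (toℕ x))))
          where
          x<2m : toℕ x < dbl m
          x<2m = subst (toℕ x <_) e≡ (≰⇒> e≰x)
          byKind : (∃[ k ] toℕ x ≡ dbl k) ⊎ (∃[ k ] toℕ x ≡ suc (dbl k)) → c (source x) ≡ c (target x)
          byKind (inj₁ (k , x≡)) = let (p , q) = ends-rim x x≡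
                                       k<m = dbl-cancel-< (subst (_< dbl m) x≡ x<2m) in
            trans (cong c p) (trans (does-¬¬ (side? (suc k)) (side? (suc (suc k)))
              (λ (m+2≤ , _) → <-irrefl refl (≤-trans (≤-pred m+2≤) (<⇒≤ k<m)))
              (λ (m+2≤ , _) → <-irrefl refl (≤-trans (≤-pred m+2≤) k<m))) (cong c (sym q)))
          byKind (inj₂ (k , x≡)) = let (p , q) = ends-spoke x x≡
                                       k<m = 1+dbl<dbl⇒< (subst (_< dbl m) x≡ x<2m) in
            trans (cong c p) (trans (does-¬¬ (side? 1) (side? (suc (suc k)))
              (λ { (s≤s () , _) })
              (λ (m+2≤ , _) → <-irrefl refl (≤-trans (≤-pred m+2≤) k<m))) (cong c (sym q)))

      -- Cutting an unlinked rim edge 2m separates the run of vertices below it, which the missing rim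
      -- edge at the start of that run also crosses.
      module PassiveRim (e : Fin n) (m : ℕ) (e≡ : toℕ e ≡ dbl m) (rim : b (dbl m) ≡ true) (unlinked-m : linked b m ≡ false) where
        Side : ℕ → Set
        Side x = x ≤ suc m × runStart b (pred x) ≡ runStart b m

        side? : ∀ x → Dec (Side x)
        side? x = (x ≤? suc m) ×-dec (runStart b (pred x) ≟ℕ runStart b m)

        c : ℕ → Bool
        c = colour side?

        hub∉Side : ¬ Side 1
        hub∉Side (_ , same) = true≢false (trans (sym (runStart≡0⇒linked b m (sym same))) unlinked-m)

        respects : Respects (S - e) c
        respects = Respects-byKind (S - e) (_≢ toℕ e) c (∈S-e e) rims spokes
          where
          rims : ∀ k → b (dbl k) ≡ true → dbl k ≢ toℕ e → c (suc k) ≡ c (suc (suc k))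
          rims k rim-k 2k≢e = does-⇔ (side? (suc k)) (side? (suc (suc k)))
            (λ (k+1≤ , same) → s≤s (≤∧≢⇒< (≤-pred k+1≤) (λ k≡m → 2k≢e (trans (cong dbl k≡m) (sym e≡)))) ,
                               trans (runStart-extend b k rim-k) same)
            (λ (k+2≤ , same) → m≤n⇒m≤1+n (≤-pred k+2≤) , trans (sym (runStart-extend b k rim-k)) same)
          spokes : ∀ k → b (suc (dbl k)) ≡ true → suc (dbl k) ≢ toℕ e → c 1 ≡ c (suc (suc k))
          spokes k spoke _ = does-¬¬ (side? 1) (side? (suc (suc k))) hub∉Side
            (λ (k+2≤ , same) → true≢false (trans (sym (linked-alongRun b (≤-pred k+2≤) same (linked-viaSpoke b k spoke))) unlinked-m))

        crosses : Crosses e c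
        crosses = crosses-rim {c} e≡ (does-≢ (side? (suc m)) (side? (suc (suc m))) (≤-refl , refl) (λ (m+2≤m+1 , _) → <-irrefl refl m+2≤m+1))

        smaller : ∃[ x ] (Crosses x c × toℕ x < toℕ e)
        smaller = fromStart (runStart b m) refl
          where
          fromStart : ∀ t → runStart b m ≡ t → ∃[ x ] (Crosses x c × toℕ x < toℕ e)
          fromStart zero start≡0 = ⊥-elim (true≢false (trans (sym (runStart≡0⇒linked b m start≡0)) unlinked-m))
          fromStart (suc s′) start≡ = x , crosses-rim {c} x≡ x-crosses , subst (toℕ x <_) (sym e≡) (subst (_< dbl m) (sym x≡) 2s′<2m)
            where
            1+s′≤m : suc s′ ≤ m
            1+s′≤m = subst (_≤ m) start≡ (runStart≤ b m)
            2s′<2m : dbl s′ < dbl m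
            2s′<2m = dbl-mono-< 1+s′≤m
            x : Fin n
            x = proj₁ (element (dbl s′) (<-trans 2s′<2m (dbl-mono-< (rim<r m rim))))
            x≡ : toℕ x ≡ dbl s′
            x≡ = proj₂ (element (dbl s′) (<-trans 2s′<2m (dbl-mono-< (rim<r m rim))))
            x-crosses : c (suc s′) ≢ c (suc (suc s′))
            x-crosses = does-≢ (side? (suc (suc s′))) (side? (suc s′))
              (s≤s 1+s′≤m , trans (cong (runStart b) (sym start≡)) (runStart-idem b m))
              (λ (_ , same) → <-irrefl refl (subst (_≤ s′) (trans same start≡) (runStart≤ b s′))) ∘ sym

      -- Cutting the spoke 2m + 1 separates the run of vertices through m + 2, which the missing rim edge at
      -- the start of that run also crosses.
      module Spoke (e : Fin n) (m : ℕ) (e≡ : toℕ e ≡ suc (dbl m)) (spoke : b (suc (dbl m)) ≡ true) where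
        Side : ℕ → Set
        Side x = runStart b (pred x) ≡ runStart b (suc m)

        side? : ∀ x → Dec (Side x)
        side? x = runStart b (pred x) ≟ℕ runStart b (suc m)

        c : ℕ → Bool
        c = colour side?

        ok-m : okAt b m ≡ true
        ok-m = wf m (<⇒≤ (spoke<r m spoke))

        hub∉Side : ¬ Side 1
        hub∉Side same = spoke-closesCycle b {0} {m} ok-m spoke z≤n same refl

        respects : Respects (S - e) c
        respects = Respects-byKind (S - e) (_≢ toℕ e) c (∈S-e e) rims spokes
          where
          rims : ∀ k → b (dbl k) ≡ true → dbl k ≢ toℕ e → c (suc k) ≡ c (suc (suc k))
          rims k rim-k _ = does-⇔ (side? (suc k)) (side? (suc (suc k)))
            (trans (runStart-extend b k rim-k)) (trans (sym (runStart-extend b k rim-k)))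
          spokes : ∀ k → b (suc (dbl k)) ≡ true → suc (dbl k) ≢ toℕ e → c 1 ≡ c (suc (suc k))
          spokes k spoke-k 2k+1≢e = does-¬¬ (side? 1) (side? (suc (suc k))) hub∉Side second-spoke
            where
            second-spoke : ¬ Side (suc (suc k))
            second-spoke same with <-cmp k m
            ... | tri≈ _ refl _ = 2k+1≢e (sym e≡)
            ... | tri< k<m _ _ = spoke-closesCycle b {suc k} {m} ok-m spoke k<m same (linked-viaSpoke b k spoke-k)
            ... | tri> _ _ m<k = spoke-closesCycle b {suc m} {k} (wf k (<⇒≤ (spoke<r k spoke-k))) spoke-k m<k
                                   (sym same) (linked-viaSpoke b m spoke)

        crosses : Crosses e c
        crosses = crosses-spoke {c} e≡ (does-≢ (side? (suc (suc m))) (side? 1) refl hub∉Side ∘ sym)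

        smaller : ∃[ x ] (Crosses x c × toℕ x < toℕ e)
        smaller = fromStart (runStart b (suc m)) refl
          where
          fromStart : ∀ t → runStart b (suc m) ≡ t → ∃[ x ] (Crosses x c × toℕ x < toℕ e)
          fromStart zero start≡0 = ⊥-elim (hub∉Side (sym start≡0))
          fromStart (suc s′) start≡ = x , crosses-rim {c} x≡ x-crosses , subst (toℕ x <_) (sym e≡) (subst (_< suc (dbl m)) (sym x≡) 2s′<2m+1)
            where
            1+s′≤1+m : suc s′ ≤ suc m
            1+s′≤1+m = subst (_≤ suc m) start≡ (runStart≤ b (suc m))
            2s′<2m+1 : dbl s′ < suc (dbl m)
            2s′<2m+1 = s≤s (dbl-mono-≤ (≤-pred 1+s′≤1+m))
            x : Fin n
            x = proj₁ (element (dbl s′) (<-trans 2s′<2m+1 (<⇒1+dbl<dbl (spoke<r m spoke))))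
            x≡ : toℕ x ≡ dbl s′
            x≡ = proj₂ (element (dbl s′) (<-trans 2s′<2m+1 (<⇒1+dbl<dbl (spoke<r m spoke))))
            x-crosses : c (suc s′) ≢ c (suc (suc s′))
            x-crosses = does-≢ (side? (suc (suc s′))) (side? (suc s′))
              (trans (cong (runStart b) (sym start≡)) (runStart-idem b (suc m)))
              (λ same → <-irrefl refl (subst (_≤ s′) (trans same start≡) (runStart≤ b s′))) ∘ sym

      separatingColouring : ∀ e → e ∈ S → ∃[ c ] (Respects (S - e) c × Crosses e c)
      separatingColouring e e∈S with even-or-odd (toℕ e)
      ... | inj₂ (m , e≡) = let spoke = trans (cong b (sym e≡)) (∈⇒code e∈S) in
        Spoke.c e m e≡ spoke , Spoke.respects e m e≡ spoke , Spoke.crosses e m e≡ spoke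
      ... | inj₁ (m , e≡) with linked b m in linked-m
      ...   | true = let rim = trans (cong b (sym e≡)) (∈⇒code e∈S) in
        ActiveRim.c e m e≡ rim linked-m , ActiveRim.respects e m e≡ rim linked-m , ActiveRim.crosses e m e≡ rim linked-m
      ...   | false = let rim = trans (cong b (sym e≡)) (∈⇒code e∈S) in
        PassiveRim.c e m e≡ rim linked-m , PassiveRim.respects e m e≡ rim linked-m , PassiveRim.crosses e m e≡ rim linked-m

      independent : Independent S
      independent i i∈S u w i-joins walk =
        let (c , respects , crosses) = separatingColouring i i∈S in
        crosses (Joins-respects⁻ c i-joins (Reach-respects c respects walk))

      basis : Basis S
      basis = connected-independent⇒Basis independent connected

      passive⇒passiveCode : ∀ e → InternallyPassive S e → passive b (toℕ e) ≡ true
      passive⇒passiveCode e (e∈S , ¬active) with even-or-odd (toℕ e)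
      ... | inj₂ (m , e≡) = trans (cong (passive b) e≡) (trans (passive-odd b m) (trans (cong b (sym e≡)) (∈⇒code e∈S)))
      ... | inj₁ (m , e≡) with linked b m in linked-m
      ...   | true = let rim = trans (cong b (sym e≡)) (∈⇒code e∈S) in
        ⊥-elim (¬active (active-if-least-crossing independent connected e∈S (ActiveRim.c e m e≡ rim linked-m)
                          (ActiveRim.respects e m e≡ rim linked-m) (ActiveRim.crosses e m e≡ rim linked-m)
                          (ActiveRim.least e m e≡ rim linked-m)))
      ...   | false = let rim = trans (cong b (sym e≡)) (∈⇒code e∈S) in
        trans (cong (passive b) e≡) (passive-rim⁺ b m rim linked-m)

      passiveCode⇒passive : ∀ e → passive b (toℕ e) ≡ true → InternallyPassive S e
      passiveCode⇒passive e h with even-or-odd (toℕ e)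
      ... | inj₂ (m , e≡) =
        let e∈S = code⇒∈ (passive⇒∈ b _ h)
            spoke = trans (cong b (sym e≡)) (∈⇒code e∈S)
            (x , x-crosses , x<e) = Spoke.smaller e m e≡ spoke in
        passive-if-smaller-crossing independent connected e∈S (Spoke.c e m e≡ spoke) (Spoke.respects e m e≡ spoke) x-crosses x<e
      ... | inj₁ (m , e≡) =
        let e∈S = code⇒∈ (passive⇒∈ b _ h)
            rim = trans (cong b (sym e≡)) (∈⇒code e∈S)
            unlinked-m = proj₂ (passive-rim⁻ b m (trans (cong (passive b) (sym e≡)) h))
            (x , x-crosses , x<e) = PassiveRim.smaller e m e≡ rim unlinked-m in
        passive-if-smaller-crossing independent connected e∈S (PassiveRim.c e m e≡ rim unlinked-m)
          (PassiveRim.respects e m e≡ rim unlinked-m) x-crosses x<e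

    module OfBasis (isBasis : Basis S) where

      -- A violated okAt is either a cycle through the hub, or a vertex k + 1 cut off from the hub for good,
      -- whose spoke 2k - 1 could then be added to S.
      wellFormed : WellFormed r b
      wellFormed k k≤r with okAt b k in ok
      ... | true = refl
      ... | false with okAt≡false b k ok
      ...   | inj₁ (linked-k , rim , spoke) =
        let (i , i≡ , i∈S) = elementAt _ spoke
            (j , j≡ , j∈S) = elementAt _ rim in
        ⊥-elim (proj₁ isBasis i i∈S 1 (suc (suc k)) (Joins-spoke i i≡) (hubCycle k linked-k i≡ j≡ j∈S))
      ...   | inj₂ (unlinked , no-rim) = ⊥-elim (isolated k k≤r unlinked no-rim)
        where
        isolated : ∀ k → k ≤ r → linked b k ≡ false → b (dbl k) ≡ false → ⊥
        isolated zero _ () _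
        isolated (suc k′) 1+k′≤r unlinked no-rim =
          proj₂ isBasis j j∉S (Independent-∪-crossing c j (proj₁ isBasis) respects crosses)
          where
          j : Fin n
          j = proj₁ (element (suc (dbl k′)) (<⇒1+dbl<dbl 1+k′≤r))
          j≡ : toℕ j ≡ suc (dbl k′)
          j≡ = proj₂ (element (suc (dbl k′)) (<⇒1+dbl<dbl 1+k′≤r))
          j∉S : j ∉ S
          j∉S j∈S = true≢false (trans (sym (linked-viaSpoke b k′ (trans (cong b (sym j≡)) (∈⇒code j∈S)))) unlinked)
          Side : ℕ → Set
          Side x = runStart b (pred x) ≡ runStart b (suc k′)
          side? : ∀ x → Dec (Side x)
          side? x = runStart b (pred x) ≟ℕ runStart b (suc k′)
          c : ℕ → Bool
          c = colour side?
          hub∉Side : ¬ Side 1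
          hub∉Side same = true≢false (trans (sym (runStart≡0⇒linked b (suc k′) (sym same))) unlinked)
          respects : Respects S c
          respects = Respects-byKind S (λ _ → ⊤) c (λ i i∈S → i∈S , tt) rims spokes
            where
            rims : ∀ q → b (dbl q) ≡ true → ⊤ → c (suc q) ≡ c (suc (suc q))
            rims q rim-q _ = does-⇔ (side? (suc q)) (side? (suc (suc q)))
              (trans (runStart-extend b q rim-q)) (trans (sym (runStart-extend b q rim-q)))
            spokes : ∀ q → b (suc (dbl q)) ≡ true → ⊤ → c 1 ≡ c (suc (suc q))
            spokes q spoke-q _ = does-¬¬ (side? 1) (side? (suc (suc q))) hub∉Side spoke∉Side
              where
              spoke∉Side : ¬ Side (suc (suc q))
              spoke∉Side same with suc q ≤? suc k′
              ... | yes q≤k′ = true≢false (trans (sym (linked-alongRun b q≤k′ same (linked-viaSpoke b q spoke-q))) unlinked)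
              ... | no q≰k′ = <-irrefl refl (≤-trans
                    (subst (_≤ runStart b (suc q)) (runStart-restart b (suc k′) no-rim) (runStart-mono b {suc (suc k′)} {suc q} (≰⇒> q≰k′)))
                    (subst (_≤ suc k′) (sym same) (runStart≤ b (suc k′))))
          crosses : Crosses j c
          crosses = crosses-spoke {c} j≡ (does-≢ (side? (suc (suc k′))) (side? 1) refl hub∉Side ∘ sym)

-- The internal order

Bool-ext : ∀ {x y} → (x ≡ true → y ≡ true) → (y ≡ true → x ≡ true) → x ≡ y
Bool-ext {true} x⇒y _ = sym (x⇒y refl)
Bool-ext {false} {true} _ y⇒x = y⇒x refl
Bool-ext {false} {false} _ _ = refl

module Perfection (r : ℕ) where
  open FanMatroid r

  wellFormed : ∀ {X} → Basis X → WellFormed r (indicator X)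
  wellFormed {X} isBasis = Code.OfBasis.wellFormed X isBasis

  vanishes : ∀ X → VanishesFrom n (indicator X)
  vanishes X = Code.vanishes X

  IP : Subset n → ℕ → Set
  IP X ℓ = passive (indicator X) ℓ ≡ true

  IP? : ∀ X ℓ → Dec (IP X ℓ)
  IP? X ℓ = passive (indicator X) ℓ Boolₚ.≟ true

  passive⇒IP : ∀ {X} e → Basis X → InternallyPassive X e → IP X (toℕ e)
  passive⇒IP {X} e isBasis = Code.OfWellFormed.passive⇒passiveCode X (wellFormed isBasis) e

  IP⇒passive : ∀ {X} e → Basis X → IP X (toℕ e) → InternallyPassive X e
  IP⇒passive {X} e isBasis = Code.OfWellFormed.passiveCode⇒passive X (wellFormed isBasis) e

  IP⇒< : ∀ X ℓ → IP X ℓ → ℓ < n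
  IP⇒< X ℓ h = Code.code⇒< X ℓ (passive⇒∈ (indicator X) ℓ h)

  IP⇒passive′ : ∀ {X} ℓ → Basis X → (h : IP X ℓ) → InternallyPassive X (fromℕ< (IP⇒< X ℓ h))
  IP⇒passive′ {X} ℓ isBasis h = IP⇒passive _ isBasis (subst (IP X) (sym (Finₚ.toℕ-fromℕ< (IP⇒< X ℓ h))) h)

  IP-block : ∀ {X} → Basis X → ∀ w → indicator X (suc (dbl w)) ≡ true → ∀ ℓ → InBlock (indicator X) w ℓ → IP X ℓ
  IP-block {X} isBasis = WellFormedCode.block-passive r (indicator X) (wellFormed isBasis) (vanishes X)

  infix 4 _⊑_
  _⊑_ : Subset n → Subset n → Set
  X ⊑ Y = ∀ ℓ → IP X ℓ → IP Y ℓ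

  ≤Int⇒⊑ : ∀ {X Y} → X ≤Int Y → X ⊑ Y
  ≤Int⇒⊑ {X} {Y} (isBasisX , isBasisY , X≤Y) ℓ h =
    subst (IP Y) (Finₚ.toℕ-fromℕ< (IP⇒< X ℓ h)) (passive⇒IP _ isBasisY (X≤Y _ (IP⇒passive′ ℓ isBasisX h)))

  ⊑⇒≤Int : ∀ {X Y} → Basis X → Basis Y → X ⊑ Y → X ≤Int Y
  ⊑⇒≤Int isBasisX isBasisY X⊑Y = isBasisX , isBasisY , λ e h → IP⇒passive e isBasisY (X⊑Y (toℕ e) (passive⇒IP e isBasisX h))

  ≤Int⇒Basis : ∀ {X Y} → X ≤Int Y → Basis X
  ≤Int⇒Basis = proj₁

  tabulate-Basis : ∀ f → WellFormed r f → VanishesFrom n f → Basis (tabulate (f ∘ toℕ))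
  tabulate-Basis f wf vanishes-f =
    Code.OfWellFormed.basis (tabulate (f ∘ toℕ)) (WellFormed-cong (sym ∘ indicator-tabulate n f vanishes-f) wf)

  IP-tabulate : ∀ f → VanishesFrom n f → ∀ ℓ → passive (indicator (tabulate {n = n} (f ∘ toℕ))) ℓ ≡ passive f ℓ
  IP-tabulate f vanishes-f = passive-cong (indicator-tabulate n f vanishes-f)

  record Drop (X Q : Subset n) (m : ℕ) : Set where
    field
      dropped : IP X m
      gone : ¬ IP Q m
      Q⊑X : Q ⊑ X
      kept : ∀ ℓ → IP X ℓ → ℓ ≢ m → IP Q ℓ

  Drop⇒Covers : ∀ {X Q m} → Basis X → Basis Q → Drop X Q m → Covers X Q
  Drop⇒Covers {X} {Q} {m} isBasisX isBasisQ drop =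
    (⊑⇒≤Int isBasisQ isBasisX Q⊑X , λ X≤Q → gone (≤Int⇒⊑ X≤Q m dropped)) ,
    λ Z (Q≤Z , Z≰Q) (Z≤X , X≰Z) → X≰Z (⊑⇒≤Int isBasisX (≤Int⇒Basis Z≤X) (X⊑Z Q≤Z Z≰Q Z≤X))
    where
    open Drop drop
    X⊑Z : ∀ {Z} → Q ≤Int Z → ¬ Z ≤Int Q → Z ≤Int X → X ⊑ Z
    X⊑Z {Z} Q≤Z Z≰Q Z≤X ℓ h with ℓ ≟ℕ m
    ... | no ℓ≢m = ≤Int⇒⊑ Q≤Z ℓ (kept ℓ h ℓ≢m)
    ... | yes refl with IP? Z ℓ
    ...   | yes Zℓ = Zℓ
    ...   | no ¬Zℓ = ⊥-elim (Z≰Q (⊑⇒≤Int (≤Int⇒Basis Z≤X) isBasisQ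
                        (λ ℓ′ h′ → kept ℓ′ (≤Int⇒⊑ Z≤X ℓ′ h′) (λ { refl → ¬Zℓ h′ }))))

  reduction : ∀ {X} → Basis X → ∀ w → indicator X (suc (dbl w)) ≡ true →
    ∃[ Q ] (Basis Q × Drop X Q (blockMin (blockStart (indicator X) w) w))
  reduction {X} isBasis w spoke = Q , isBasisQ , record
    { dropped = IP-block isBasis w spoke m (blockMin-inBlock (blockStart b w) w)
    ; gone = gone
    ; Q⊑X = λ ℓ h → trans (sym (keeps ℓ (λ { refl → gone h }))) (trans (sym (IP-tabulate code vanishes′ ℓ)) h)
    ; kept = λ ℓ h ℓ≢m → trans (IP-tabulate code vanishes′ ℓ) (trans (keeps ℓ ℓ≢m) h)
    }
    where
    b : ℕ → Bool
    b = indicator X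
    m : ℕ
    m = blockMin (blockStart b w) w
    open Reduct (Reduction.reduce r b (wellFormed isBasis) (vanishes X) w spoke) renaming (wellFormed to wellFormed′; vanishes to vanishes′)
    Q : Subset n
    Q = tabulate (code ∘ toℕ)
    isBasisQ : Basis Q
    isBasisQ = tabulate-Basis code wellFormed′ vanishes′
    gone : ¬ IP Q m
    gone h = true≢false (trans (sym h) (trans (IP-tabulate code vanishes′ m) drops))

  IPInBlock : Subset n → ℕ → Set
  IPInBlock X w = ∀ ℓ → IP X ℓ → InBlock (indicator X) w ℓ

  -- Any basis Y covered by X loses the least block element (else the block argument gives X ⊑ Y),
  -- hence Y ⊑ Q; and Q ⊑ Y, since otherwise Y < Q < X.
  inBlock⇒JoinIrreducible : ∀ {X} → Basis X → ∀ w → indicator X (suc (dbl w)) ≡ true → IPInBlock X w →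
    JoinIrreducible X
  inBlock⇒JoinIrreducible {X} isBasis w spoke inBlock = isBasis , Q , X-covers-Q , unique
    where
    m : ℕ
    m = blockMin (blockStart (indicator X) w) w
    Q : Subset n
    Q = proj₁ (reduction isBasis w spoke)
    isBasisQ : Basis Q
    isBasisQ = proj₁ (proj₂ (reduction isBasis w spoke))
    drop : Drop X Q m
    drop = proj₂ (proj₂ (reduction isBasis w spoke))
    open Drop drop
    X-covers-Q : Covers X Q
    X-covers-Q = Drop⇒Covers isBasis isBasisQ drop
    unique : ∀ Y → Covers X Y → Y ≡ Q
    unique Y ((Y≤X , X≰Y) , Y-covered) =
      indicator-injective (passive-injective r _ _ (wellFormed isBasisY) (wellFormed isBasisQ) (vanishes Y) (vanishes Q)
        (λ ℓ → Bool-ext (Y⊑Q ℓ) (Q⊑Y ℓ)))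
      where
      isBasisY : Basis Y
      isBasisY = ≤Int⇒Basis Y≤X
      ¬IPYm : ¬ IP Y m
      ¬IPYm h = X≰Y (⊑⇒≤Int isBasis isBasisY λ ℓ IPXℓ →
        WellFormedCode.block-closed r (indicator Y) (wellFormed isBasisY) (vanishes Y) (blockStart (indicator X) w) w
          (λ ℓ′ IPYℓ′ → inBlock ℓ′ (≤Int⇒⊑ Y≤X ℓ′ IPYℓ′)) h ℓ (inBlock ℓ IPXℓ))
      Y⊑Q : Y ⊑ Q
      Y⊑Q ℓ h = kept ℓ (≤Int⇒⊑ Y≤X ℓ h) (λ { refl → ¬IPYm h })
      Q⊑Y : Q ⊑ Y
      Q⊑Y ℓ h with IP? Y ℓ
      ... | yes IPYℓ = IPYℓ
      ... | no ¬IPYℓ = ⊥-elim (Y-covered Q (⊑⇒≤Int isBasisY isBasisQ Y⊑Q , λ Q≤Y → ¬IPYℓ (≤Int⇒⊑ Q≤Y ℓ h)) (proj₁ X-covers-Q))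

  InBlock-unique : ∀ {X} → Basis X → ∀ w w′ ℓ → indicator X (suc (dbl w)) ≡ true → indicator X (suc (dbl w′)) ≡ true →
    InBlock (indicator X) w ℓ → InBlock (indicator X) w′ ℓ → w ≡ w′
  InBlock-unique _ w w′ ℓ _ _ (inj₁ refl) (inj₁ e) = dbl-injective (suc-injective e)
  InBlock-unique _ w w′ ℓ _ _ (inj₁ refl) (inj₂ (_ , e , _)) = ⊥-elim (dbl≢1+dbl (sym e))
  InBlock-unique _ w w′ ℓ _ _ (inj₂ (_ , refl , _)) (inj₁ e) = ⊥-elim (dbl≢1+dbl e)
  InBlock-unique {X} isBasis w w′ ℓ spoke spoke′ (inj₂ (j , refl , s≤j , j≤w)) (inj₂ (j′ , e , s′≤j′ , j′≤w′))
    with refl ← dbl-injective e =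
    WellFormedCode.blocks-disjoint r (indicator X) (wellFormed isBasis) (vanishes X) w w′ j spoke spoke′ s≤j j≤w s′≤j′ j′≤w′

  IP⇒InBlock : ∀ {X} → Basis X → ∀ ℓ → IP X ℓ → ∃[ w ] (indicator X (suc (dbl w)) ≡ true × InBlock (indicator X) w ℓ)
  IP⇒InBlock {X} isBasis ℓ h with even-or-odd ℓ
  ... | inj₂ (k , refl) = k , trans (sym (passive-odd _ k)) h , inj₁ refl
  ... | inj₁ (k , refl) = WellFormedCode.passive-rim-inBlock r (indicator X) (wellFormed isBasis) (vanishes X) k h

  -- Reducing at two different spokes would give two different covered bases.
  JoinIrreducible⇒uniqueSpoke : ∀ {X} → JoinIrreducible X → ∀ w w′ →
    indicator X (suc (dbl w)) ≡ true → indicator X (suc (dbl w′)) ≡ true → w ≡ w′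
  JoinIrreducible⇒uniqueSpoke {X} (isBasis , _ , _ , unique) w w′ spoke spoke′ with w ≟ℕ w′
  ... | yes w≡w′ = w≡w′
  ... | no w≢w′ = ⊥-elim (Drop.gone drop (subst (λ Z → IP Z m) Q′≡Q (Drop.kept drop′ m (Drop.dropped drop) m≢m′)))
    where
    b : ℕ → Bool
    b = indicator X
    m m′ : ℕ
    m = blockMin (blockStart b w) w
    m′ = blockMin (blockStart b w′) w′
    Q Q′ : Subset n
    Q = proj₁ (reduction isBasis w spoke)
    Q′ = proj₁ (reduction isBasis w′ spoke′)
    drop : Drop X Q m
    drop = proj₂ (proj₂ (reduction isBasis w spoke))
    drop′ : Drop X Q′ m′
    drop′ = proj₂ (proj₂ (reduction isBasis w′ spoke′))
    Q′≡Q : Q′ ≡ Q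
    Q′≡Q = trans (unique Q′ (Drop⇒Covers isBasis (proj₁ (proj₂ (reduction isBasis w′ spoke′))) drop′))
                 (sym (unique Q (Drop⇒Covers isBasis (proj₁ (proj₂ (reduction isBasis w spoke))) drop)))
    m≢m′ : m ≢ m′
    m≢m′ m≡m′ = w≢w′ (InBlock-unique isBasis w w′ m spoke spoke′ (blockMin-inBlock (blockStart b w) w)
                        (subst (InBlock b w′) (sym m≡m′) (blockMin-inBlock (blockStart b w′) w′)))

  principal⇒InBlock : ∀ {X f} → Principal X f →
    ∃[ w ] (toℕ f ≡ suc (dbl w) × indicator X (suc (dbl w)) ≡ true × IPInBlock X w)
  principal⇒InBlock {X} {f} (joinIrreducible , f-passive , f-max) =
    let (w , spoke , _) = IP⇒InBlock isBasis (toℕ f) (passive⇒IP f isBasis f-passive) in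
    w , f≡ w spoke , spoke , inBlock w spoke
    where
    isBasis : Basis X
    isBasis = proj₁ joinIrreducible
    b : ℕ → Bool
    b = indicator X
    inBlock : ∀ w → b (suc (dbl w)) ≡ true → IPInBlock X w
    inBlock w spoke ℓ h =
      let (w′ , spoke′ , inBlock′) = IP⇒InBlock isBasis ℓ h in
      subst (λ t → InBlock b t ℓ) (JoinIrreducible⇒uniqueSpoke joinIrreducible w′ w spoke′ spoke) inBlock′
    f≡ : ∀ w → b (suc (dbl w)) ≡ true → toℕ f ≡ suc (dbl w)
    f≡ w spoke with inBlock w spoke (toℕ f) (passive⇒IP f isBasis f-passive)
    ... | inj₁ e = e
    ... | inj₂ (j , e , _ , j≤w) = ⊥-elim (<⇒≱ (subst (_< suc (dbl w)) (sym e) (s≤s (dbl-mono-≤ j≤w))) spoke≤f)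
      where
      2w+1<n : suc (dbl w) < n
      2w+1<n = IP⇒< X _ (trans (passive-odd b w) spoke)
      spoke≤f : suc (dbl w) ≤ toℕ f
      spoke≤f = subst (_≤ toℕ f) (Finₚ.toℕ-fromℕ< 2w+1<n)
        (f-max _ (IP⇒passive _ isBasis (subst (IP X) (sym (Finₚ.toℕ-fromℕ< 2w+1<n)) (trans (passive-odd b w) spoke))))

  principalBelow⇒InBlock : ∀ {B P f} → Principal P f → P ≤Int B →
    ∃[ w ] (toℕ f ≡ suc (dbl w) × indicator B (suc (dbl w)) ≡ true × (∀ ℓ → IP P ℓ → InBlock (indicator B) w ℓ))
  principalBelow⇒InBlock {B} {P} principal P≤B with principal⇒InBlock principal
  ... | w , f≡ , spoke , inBlock = w , f≡ , spokeB , inBlockB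
    where
    b : ℕ → Bool
    b = indicator B
    spokeB : b (suc (dbl w)) ≡ true
    spokeB = trans (sym (passive-odd b w)) (≤Int⇒⊑ P≤B (suc (dbl w)) (trans (passive-odd (indicator P) w) spoke))
    inBlockB : ∀ ℓ → IP P ℓ → InBlock b w ℓ
    inBlockB ℓ h with inBlock ℓ h
    ... | inj₁ e = inj₁ e
    ... | inj₂ (j , e , s≤j , j≤w) = inj₂ (j , e , blockStart-least b w j run , j≤w)
      where
      run : ∀ j′ → j ≤ j′ → j′ ≤ w → passive b (dbl j′) ≡ true
      run j′ j≤j′ j′≤w = ≤Int⇒⊑ P≤B (dbl j′) (blockStart-run (indicator P) w j′ (≤-trans s≤j j≤j′) j′≤w)

  -- The maximal principal basis below B belonging to the spoke 2w + 1 of B: its passive set is the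
  -- block of w in B.
  module PrincipalOfSpoke {B : Subset n} (isBasisB : Basis B) (w : ℕ) (spoke : indicator B (suc (dbl w)) ≡ true) where
    b : ℕ → Bool
    b = indicator B
    s : ℕ
    s = blockStart b w

    w<r : w < r
    w<r = WellFormedCode.spoke<r r b (wellFormed isBasisB) (vanishes B) w spoke

    open PrincipalCode r s w (1≤blockStart b w) (blockStart≤ b w) w<r
      using (inBlock⇒passive; passive⇒inBlock; spoke-present)
      renaming (p to code; wellFormed to code-wellFormed; vanishes to code-vanishes)

    P : Subset n
    P = tabulate (code ∘ toℕ)

    isBasis : Basis P
    isBasis = tabulate-Basis code code-wellFormed code-vanishes

    IP⇒InBlock′ : ∀ ℓ → IP P ℓ → InBlock′ s w ℓ
    IP⇒InBlock′ ℓ h = passive⇒inBlock ℓ (trans (sym (IP-tabulate code code-vanishes ℓ)) h)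

    InBlock′⇒IP : ∀ ℓ → InBlock′ s w ℓ → IP P ℓ
    InBlock′⇒IP ℓ inBlock = trans (IP-tabulate code code-vanishes ℓ) (inBlock⇒passive ℓ inBlock)

    blockStart-P : blockStart (indicator P) w ≡ s
    blockStart-P = ≤-antisym (blockStart-least (indicator P) w s (λ j s≤j j≤w → InBlock′⇒IP _ (inj₂ (j , refl , s≤j , j≤w))))
                             (below s refl (1≤blockStart b w))
      where
      below : ∀ t → s ≡ t → 1 ≤ t → t ≤ blockStart (indicator P) w
      below (suc s′) s≡ _ = blockStart-above (indicator P) w s′ (≤-pred (subst (_≤ suc w) s≡ (blockStart≤ b w))) ¬passive
        where
        ¬passive : passive (indicator P) (dbl s′) ≡ false
        ¬passive with passive (indicator P) (dbl s′) in h
        ... | false = refl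
        ... | true with IP⇒InBlock′ (dbl s′) h
        ...   | inj₁ e = ⊥-elim (dbl≢1+dbl e)
        ...   | inj₂ (j , e , s≤j , _) = ⊥-elim (<-irrefl refl (subst (suc s′ ≤_) (sym (dbl-injective e)) (subst (_≤ j) s≡ s≤j)))

    spoke-P : indicator P (suc (dbl w)) ≡ true
    spoke-P = trans (indicator-tabulate n code code-vanishes _) spoke-present

    f : Fin n
    f = fromℕ< (<⇒1+dbl<dbl w<r)

    f≡ : toℕ f ≡ suc (dbl w)
    f≡ = Finₚ.toℕ-fromℕ< (<⇒1+dbl<dbl w<r)

    principal : Principal P f
    principal =
      inBlock⇒JoinIrreducible isBasis w spoke-P (λ ℓ h → subst (λ t → InBlock′ t w ℓ) (sym blockStart-P) (IP⇒InBlock′ ℓ h)) ,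
      IP⇒passive f isBasis (subst (IP P) (sym f≡) (InBlock′⇒IP _ (inj₁ refl))) ,
      f-max
      where
      f-max : ∀ x → InternallyPassive P x → toℕ x ≤ toℕ f
      f-max x x-passive with IP⇒InBlock′ _ (passive⇒IP x isBasis x-passive)
      ... | inj₁ e = ≤-reflexive (trans e (sym f≡))
      ... | inj₂ (j , e , _ , j≤w) = subst₂ _≤_ (sym e) (sym f≡) (m≤n⇒m≤1+n (dbl-mono-≤ j≤w))

    P≤B : P ≤Int B
    P≤B = ⊑⇒≤Int isBasis isBasisB (λ ℓ h → IP-block isBasisB w spoke ℓ (IP⇒InBlock′ ℓ h))

    maximal : ∀ P′ f′ → Principal P′ f′ → P′ ≤Int B → ¬ (P <Int P′)
    maximal P′ f′ principal′ P′≤B (P≤P′ , P′≰P) = P′≰P (⊑⇒≤Int (≤Int⇒Basis P′≤B) isBasis P′⊑P)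
      where
      w′ : ℕ
      w′ = proj₁ (principalBelow⇒InBlock principal′ P′≤B)
      inBlock′ : ∀ ℓ → IP P′ ℓ → InBlock b w′ ℓ
      inBlock′ = proj₂ (proj₂ (proj₂ (principalBelow⇒InBlock principal′ P′≤B)))
      w≡w′ : w ≡ w′
      w≡w′ with inBlock′ _ (≤Int⇒⊑ P≤P′ (suc (dbl w)) (InBlock′⇒IP _ (inj₁ refl)))
      ... | inj₁ e = dbl-injective (suc-injective e)
      ... | inj₂ (_ , e , _) = ⊥-elim (dbl≢1+dbl (sym e))
      P′⊑P : P′ ⊑ P
      P′⊑P ℓ h = InBlock′⇒IP ℓ (subst (λ t → InBlock b t ℓ) (sym w≡w′) (inBlock′ ℓ h))

    maxPrincipalBelow : MaxPrincipalBelow B P f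
    maxPrincipalBelow = principal , P≤B , maximal

  module _ {B : Subset n} (isBasisB : Basis B) where
    private
      b : ℕ → Bool
      b = indicator B

    part⇒rimInBlock : ∀ {e f P} → InPart B f P e →
      ∃[ w ] (toℕ f ≡ suc (dbl w) × b (suc (dbl w)) ≡ true × ∃[ j ] (toℕ e ≡ dbl j × blockStart b w ≤ j × j ≤ w))
    part⇒rimInBlock {e} ((principal , P≤B , _) , e-passive , e≢f) =
      let (w , f≡ , spoke , inBlock) = principalBelow⇒InBlock principal P≤B in
      [ (λ e≡ → ⊥-elim (e≢f (Finₚ.toℕ-injective (trans e≡ (sym f≡))))) , (λ rim → w , f≡ , spoke , rim) ]′
        (inBlock _ (passive⇒IP e (≤Int⇒Basis P≤B) e-passive))

    InS⇒spoke : ∀ {f} → InS B f → ∃[ w ] toℕ f ≡ suc (dbl w)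
    InS⇒spoke (_ , principal , P≤B , _) = let (w , f≡ , _) = principalBelow⇒InBlock principal P≤B in w , f≡

    spoke⇒InS : ∀ e k → toℕ e ≡ suc (dbl k) → b (suc (dbl k)) ≡ true → InS B e
    spoke⇒InS e k e≡ spoke =
      PrincipalOfSpoke.P isBasisB k spoke ,
      subst (MaxPrincipalBelow B (PrincipalOfSpoke.P isBasisB k spoke))
        (Finₚ.toℕ-injective (trans (PrincipalOfSpoke.f≡ isBasisB k spoke) (sym e≡)))
        (PrincipalOfSpoke.maxPrincipalBelow isBasisB k spoke)

    rimInBlock⇒part : ∀ e k w → toℕ e ≡ dbl k → (spoke : b (suc (dbl w)) ≡ true) → InBlock b w (dbl k) →
      ∃[ f ] ∃[ P ] InPart B f P e
    rimInBlock⇒part e k w e≡ spoke inBlock =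
      PrincipalOfSpoke.f isBasisB w spoke , PrincipalOfSpoke.P isBasisB w spoke ,
      PrincipalOfSpoke.maxPrincipalBelow isBasisB w spoke ,
      IP⇒passive e (PrincipalOfSpoke.isBasis isBasisB w spoke)
        (subst (IP (PrincipalOfSpoke.P isBasisB w spoke)) (sym e≡) (PrincipalOfSpoke.InBlock′⇒IP isBasisB w spoke _ inBlock)) ,
      λ e≡f → dbl≢1+dbl (trans (sym e≡) (trans (cong toℕ e≡f) (PrincipalOfSpoke.f≡ isBasisB w spoke)))

    T⇒parts : ∀ e → InT B e → ∃[ f ] ∃[ P ] InPart B f P e
    T⇒parts e (e-passive , e∉S) =
      [ (λ (k , e≡) → let (w , spoke , inBlock) = rim-inBlock k e≡ in rimInBlock⇒part e k w e≡ spoke inBlock)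
      , (λ (k , e≡) → ⊥-elim (e∉S (spoke⇒InS e k e≡ (trans (sym (passive-odd b k)) (IP-e e≡))))) ]′
        (even-or-odd (toℕ e))
      where
      IP-e : ∀ {ℓ} → toℕ e ≡ ℓ → IP B ℓ
      IP-e e≡ = subst (IP B) e≡ (passive⇒IP e isBasisB e-passive)
      rim-inBlock : ∀ k → toℕ e ≡ dbl k → ∃[ w ] (b (suc (dbl w)) ≡ true × InBlock b w (dbl k))
      rim-inBlock k e≡ = WellFormedCode.passive-rim-inBlock r b (wellFormed isBasisB) (vanishes B) k (IP-e e≡)

    parts⇒T : ∀ e → ∃[ f ] ∃[ P ] InPart B f P e → InT B e
    parts⇒T e (f , P , part) =
      let (w , _ , spoke , j , e≡ , s≤j , j≤w) = part⇒rimInBlock part in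
      IP⇒passive e isBasisB (IP-block isBasisB w spoke _ (inj₂ (j , e≡ , s≤j , j≤w))) ,
      λ e∈S → let (_ , e≡′) = InS⇒spoke e∈S in dbl≢1+dbl (trans (sym e≡) e≡′)

    parts-disjoint : ∀ e f f′ P P′ → InPart B f P e → InPart B f′ P′ e → f ≡ f′
    parts-disjoint e f f′ P P′ part part′ =
      let (w , f≡ , spoke , j , e≡ , s≤j , j≤w) = part⇒rimInBlock part
          (w′ , f′≡ , spoke′ , j′ , e≡′ , s′≤j′ , j′≤w′) = part⇒rimInBlock part′
          w≡w′ = WellFormedCode.blocks-disjoint r b (wellFormed isBasisB) (vanishes B) w w′ j spoke spoke′ s≤j j≤w
                   (subst (blockStart b w′ ≤_) (sym (dbl-injective (trans (sym e≡) e≡′))) s′≤j′)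
                   (subst (_≤ w′) (sym (dbl-injective (trans (sym e≡) e≡′))) j′≤w′) in
      Finₚ.toℕ-injective (trans f≡ (trans (cong (suc ∘ dbl) w≡w′) (sym f′≡)))

    perfect : InternallyPerfectBasis B
    perfect = (λ e → mk⇔ (T⇒parts e) (parts⇒T e)) , parts-disjoint

mainTheorem1 : (r : ℕ) → r ≥ 1 → InternallyPerfectM r
mainTheorem1 r _ B isBasis = Perfection.perfect r isBasis
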